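{- For every $n \times n$ Hankel matrix $H$ over $\mathbb{F}_q$ we have $\mathcal{Q}(H)=\mathcal{Q}(\mathcal{R}(H))$, $\mathcal{Q}_{\mathcal{M}}(H)=\mathcal{Q}_{\mathcal{M}}(\mathcal{R}(H))$, and $\mathcal{Q}_1(H)=\mathcal{Q}_1(\mathcal{R}(H))$.
   Context: An $n\times n$ Hankel matrix over $\mathbb{F}_q$ is $(\alpha_{i+j-2})_{1\le i,j\le n}$ with $\alpha_i\in\mathbb{F}_q$; $H[a,a]$ is the top-left $a\times a$ submatrix. A non-strict lower skew-triangular Hankel matrix is a square Hankel matrix $(\beta_{i+j-2})_{1\le i,j\le l}$ with $\beta_0=\dots=\beta_{l-2}=0\neq\beta_{l-1}$. Strict $(\rho,\pi)$-characteristic: $\rho_s(H)$ is the largest $\rho_1\in\{1,\dots,n-1\}$ with $H[\rho_1,\rho_1]$ invertible, or $0$ if none; $\pi_s(H)=\operatorname{rank}H-\rho_s(H)$. Reduced $(\rho,\pi)$-form $\mathcal{R}(H)$: if $\rho_s(H)=0$, $\mathcal{R}(H):=H$. If $\rho_1:=\rho_s(H)\ge1$, let $\mathbf{x}=(x_0,\dots,x_{\rho_1-1})^T$ solve $H[\rho_1,\rho_1]\mathbf{x}=(\alpha_{\rho_1},\dots,\alpha_{2\rho_1-1})^T$; apply row operations $R_i\to R_i-x_0R_{i-\rho_1}-\dots-x_{\rho_1-1}R_{i-1}$ for $i=n,\dots,\rho_1+1$ in that order, then the analogous column operations, obtaining $\mathrm{diag}(H[\rho_1,\rho_1],0_{n-\operatorname{rank}H},H_1')$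 with $H_1'$ a $\pi_s(H)\times\pi_s(H)$ non-strict lower skew-triangular Hankel matrix; then recursively apply the procedure to $H[\rho_1,\rho_1]$, etc., yielding $\mathcal{R}(H)=\mathrm{diag}(H_t,\dots,H_2,H_1'',H_1')$ with $H_1''$ zero and $H_2,\dots,H_t$ non-strict lower skew-triangular Hankel. Multisets: for an $n\times n$ matrix $M$ over $\mathbb{F}_q$, $\mathcal{Q}(M):=[\mathbf{v}^TM\mathbf{v}:\mathbf{v}\in\mathbb{F}_q^n]$, $\mathcal{Q}_{\mathcal{M}}(M):=[\mathbf{v}^TM\mathbf{v}:\mathbf{v}\in\mathbb{F}_q^{n-1}\times\{1\}]$, and $\mathcal{Q}_1(M):=[\mathbf{v}^TM\mathbf{v}:\mathbf{v}\in\mathbb{F}_q^n,\ l(\mathbf{v})=1]$, where $l(\mathbf{v})$ is the last nonzero entry of $\mathbf{v}$ ($0$ if $\mathbf{v}=0$). These are multisets (values counted with multiplicity). -}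

module Defs where

open import Function using (_∘_)
open import Data.Nat as ℕ using (ℕ; zero; suc; _<_; _≤_; _∸_; _<?_; _≡ᵇ_)
open import Data.Nat.Properties using (<-trans; n<1+n; <⇒≤)
open import Data.Fin as Fin using (Fin; zero; suc; toℕ; fromℕ<; inject≤)
open import Data.Fin.Properties using (all?)
open import Data.Vec.Functional as V using (Vector; head; tail)
open import Data.List as List using (List; []; _∷_; map; concatMap; filter; foldl; take; downFrom)
open import Data.List.Relation.Unary.Any as Any using (Any; here; there; any?)
open import Data.List.Relation.Unary.Any.Properties using (++⁺ˡ; ++⁺ʳ; map⁺)
open import Data.List.Membership.Propositional using (_∈_)
open import Data.List.Relation.Unary.Unique.Propositional using (Unique)
open import Data.Maybe using (Maybe; just; nothing; maybe)
open import Data.Product using (Σ; ∃; _×_; _,_; proj₁; proj₂)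
open import Data.Bool using (if_then_else_)
open import Relation.Nullary using (Dec; yes; no; ¬_)
open import Relation.Nullary.Decidable using (_×-dec_)
open import Relation.Binary.PropositionalEquality using (_≡_; _≢_; refl; sym; trans; cong; cong₂)
open import Relation.Binary using (DecidableEquality)
open import Algebra.Structures using (IsCommutativeRing)

record FiniteField : Set₁ where
  infixl 7 _*_
  infixl 6 _+_
  field
    Carrier           : Set
    _+_ _*_           : Carrier → Carrier → Carrier
    -_                : Carrier → Carrier
    0# 1#             : Carrier
    isCommutativeRing : IsCommutativeRing _≡_ _+_ _*_ -_ 0# 1#
    0≢1               : 0# ≢ 1#
    inverse           : ∀ x → x ≢ 0# → ∃ λ y → x * y ≡ 1#
    _≟_               : DecidableEquality Carrier
    elements          : List Carrier
    elements-complete : ∀ x → x ∈ elements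
    elements-unique   : Unique elements

allFuns : ∀ {A : Set} → List A → (n : ℕ) → List (Fin n → A)
allFuns xs zero    = (λ ()) ∷ []
allFuns xs (suc n) = concatMap (λ a → map (a V.∷_) (allFuns xs n)) xs

allFuns-complete : ∀ {A : Set} (R : A → A → Set) (xs : List A) →
                   (∀ a → Any (R a) xs) →
                   ∀ n (f : Fin n → A) →
                   Any (λ g → ∀ i → R (f i) (g i)) (allFuns xs n)
allFuns-complete R xs c zero    f = here (λ ())
allFuns-complete R xs c (suc n) f = go xs (c (f zero))
  where
  rest = allFuns-complete R xs c n (f ∘ suc)
  go : ∀ ys → Any (R (f zero)) ys →
       Any (λ g → ∀ i → R (f i) (g i))
           (concatMap (λ a → map (a V.∷_) (allFuns xs n)) ys)
  go (y ∷ ys) (here r)  =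
    ++⁺ˡ (map⁺ (Any.map (λ p → λ { zero → r ; (suc i) → p i }) rest))
  go (y ∷ ys) (there a) = ++⁺ʳ (map (y V.∷_) (allFuns xs n)) (go ys a)

module FF (F : FiniteField) where
  open FiniteField F

  infixl 6 _-_
  _-_ : Carrier → Carrier → Carrier
  x - y = x + (- y)

  Vec : ℕ → Set
  Vec n = Fin n → Carrier

  Mat : ℕ → Set
  Mat n = Fin n → Fin n → Carrier

  sumF : ∀ {n} → (Fin n → Carrier) → Carrier
  sumF {zero}  f = 0#
  sumF {suc n} f = f zero + sumF (f ∘ suc)

  sumF-cong : ∀ {n} {f g : Fin n → Carrier} → (∀ i → f i ≡ g i) → sumF f ≡ sumF g
  sumF-cong {zero}  p = refl
  sumF-cong {suc n} p = cong₂ _+_ (p zero) (sumF-cong (p ∘ suc))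

  infixl 7 _·_
  _·_ : ∀ {k} → Mat k → Mat k → Mat k
  (A · B) i j = sumF λ l → A i l * B l j

  I : ∀ {k} → Mat k
  I i j with i Fin.≟ j
  ... | yes _ = 1#
  ... | no  _ = 0#

  _≐_ : ∀ {k} → Mat k → Mat k → Set
  A ≐ B = ∀ i j → A i j ≡ B i j

  IsInverse : ∀ {k} → Mat k → Mat k → Set
  IsInverse A B = ((A · B) ≐ I) × ((B · A) ≐ I)

  Invertible : ∀ {k} → Mat k → Set
  Invertible {k} A = Σ (Mat k) (IsInverse A)

  IsHankel : ∀ {n} → Mat n → Set
  IsHankel H = ∀ i j i′ j′ → toℕ i ℕ.+ toℕ j ≡ toℕ i′ ℕ.+ toℕ j′ → H i j ≡ H i′ j′

  sub : ∀ {a n} → a ≤ n → Mat n → Mat a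
  sub p M i j = M (inject≤ i p) (inject≤ j p)

  allVecs : ∀ n → List (Vec n)
  allVecs n = allFuns elements n

  allMats : ∀ k → List (Mat k)
  allMats k = allFuns (allFuns elements k) k

  mats-complete : ∀ k (B : Mat k) → Any (λ C → B ≐ C) (allMats k)
  mats-complete k B =
    allFuns-complete (λ u v → ∀ j → u j ≡ v j) (allFuns elements k)
      (allFuns-complete _≡_ elements elements-complete k) k B

  ·-congʳ : ∀ {k} (A : Mat k) {B C : Mat k} → B ≐ C → (A · B) ≐ (A · C)
  ·-congʳ A p i j = sumF-cong λ l → cong (A i l *_) (p l j)

  ·-congˡ : ∀ {k} {B C : Mat k} (A : Mat k) → B ≐ C → (B · A) ≐ (C · A)
  ·-congˡ A p i j = sumF-cong λ l → cong (_* A l j) (p i l)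

  isInverse? : ∀ {k} (A B : Mat k) → Dec (IsInverse A B)
  isInverse? A B =
    (all? λ i → all? λ j → (A · B) i j ≟ I i j) ×-dec
    (all? λ i → all? λ j → (B · A) i j ≟ I i j)

  invertible? : ∀ {k} (A : Mat k) → Dec (Invertible A)
  invertible? {k} A with any? (isInverse? A) (allMats k)
  ... | yes p = yes (Any.satisfied p)
  ... | no ¬p = no λ { (B , inv) →
          ¬p (Any.map (λ {C} B≐C →
                (λ i j → trans (sym (·-congʳ A B≐C i j)) (proj₁ inv i j)) ,
                (λ i j → trans (sym (·-congˡ A B≐C i j)) (proj₂ inv i j)))
              (mats-complete k B)) }

  -- strict (ρ,π)-characteristic: ρ_s(H) = largest ρ₁ ∈ {1,…,n-1} with
  -- H[ρ₁,ρ₁] invertible (0 if none)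

  record Pivot {n} (M : Mat n) : Set where
    constructor pivot
    field
      r   : ℕ
      1≤r : 1 ≤ r
      r<n : r < n
      inv : Invertible (sub (<⇒≤ r<n) M)

  search : ∀ {n} (M : Mat n) (k : ℕ) → k < n → Maybe (Pivot M)
  search M zero    _ = nothing
  search M (suc k) p with invertible? (sub (<⇒≤ p) M)
  ... | yes iv = just (pivot (suc k) (ℕ.s≤s ℕ.z≤n) p iv)
  ... | no  _  = search M k (<-trans (n<1+n k) p)

  pivotOf : ∀ {n} (M : Mat n) → Maybe (Pivot M)
  pivotOf {zero}  M = nothing
  pivotOf {suc m} M = search M m (n<1+n m)

  ρs : ∀ {n} → Mat n → ℕ
  ρs M = maybe Pivot.r 0 (pivotOf M)

  ent : ∀ {n} → Mat n → ℕ → ℕ → Carrier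
  ent {n} M a b with a <? n | b <? n
  ... | yes p | yes q = M (fromℕ< p) (fromℕ< q)
  ... | _     | _     = 0#

  -- R_i → R_i - x_0 R_{i-r} - … - x_{r-1} R_{i-1}   (0-indexed row i)
  rowOp : ∀ {n r} → Vec r → Mat n → ℕ → Mat n
  rowOp {n} {r} x M i p j =
    if toℕ p ≡ᵇ i
    then M p j - sumF (λ k → x k * ent M (i ∸ r ℕ.+ toℕ k) (toℕ j))
    else M p j

  -- C_j → C_j - x_0 C_{j-r} - … - x_{r-1} C_{j-1}   (0-indexed column j)
  colOp : ∀ {n r} → Vec r → Mat n → ℕ → Mat n
  colOp {n} {r} x M j p q =
    if toℕ q ≡ᵇ j
    then M p q - sumF (λ k → x k * ent M (toℕ p) (j ∸ r ℕ.+ toℕ k))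
    else M p q

  -- indices n-1, n-2, …, r (i.e. 1-indexed n, …, r+1), in that order
  opIndices : ℕ → ℕ → List ℕ
  opIndices n r = take (n ∸ r) (downFrom n)

  rowOps colOps : ∀ {n r} → Vec r → Mat n → Mat n
  rowOps {n} {r} x M = foldl (rowOp x) M (opIndices n r)
  colOps {n} {r} x M = foldl (colOp x) M (opIndices n r)

  replaceTL : ∀ {r n} → r ≤ n → Mat r → Mat n → Mat n
  replaceTL {r} p A M i j with toℕ i <? r | toℕ j <? r
  ... | yes a | yes b = A (fromℕ< a) (fromℕ< b)
  ... | _     | _     = M i j

  -- x solves H[r,r] x = (α_r,…,α_{2r-1})^T; with B the inverse of
  -- H[r,r], x = B b where b_i = H (i, r)  (0-indexed), i < r.
  solveX : ∀ {n r} (M : Mat n) (p : r < n) → Mat r → Vec r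
  solveX M p B i = sumF λ j → B i j * M (inject≤ j (<⇒≤ p)) (fromℕ< p)

  -- the procedure, with fuel (fuel n suffices since ρ₁ < n at each step)
  reduceF : ℕ → ∀ {n} → Mat n → Mat n
  reduceF zero    M = M
  reduceF (suc f) M with pivotOf M
  ... | nothing = M
  ... | just (pivot r _ p (B , _)) =
    replaceTL (<⇒≤ p) (reduceF f (sub (<⇒≤ p) M)) (colOps x (rowOps x M))
    where x = solveX M p B

  𝓡 : ∀ {n} → Mat n → Mat n
  𝓡 {n} M = reduceF n M

  -- Multisets of quadratic-form values (as lists, compared up to
  -- permutation)

  quad : ∀ {n} → Mat n → Vec n → Carrier
  quad M v = sumF λ i → sumF λ j → v i * M i j * v j

  snoc : ∀ {m} → Vec m → Carrier → Vec (suc m)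
  snoc {zero}  w c = c V.∷ (λ ())
  snoc {suc m} w c = w zero V.∷ snoc (w ∘ suc) c

  -- l(v): last nonzero entry of v, 0 if v = 0
  lastNZ : ∀ {n} → Vec n → Carrier
  lastNZ {zero}  v = 0#
  lastNZ {suc n} v with lastNZ (tail v) ≟ 0#
  ... | yes _ = head v
  ... | no  _ = lastNZ (tail v)

  𝒬 : ∀ {n} → Mat n → List Carrier
  𝒬 {n} M = map (quad M) (allVecs n)

  -- 𝒬_𝓜(M) = [vᵀMv : v ∈ F^{n-1} × {1}]   (empty for n = 0)
  𝒬𝓜 : ∀ {n} → Mat n → List Carrier
  𝒬𝓜 {zero}  M = []
  𝒬𝓜 {suc m} M = map (λ w → quad M (snoc w 1#)) (allVecs m)

  𝒬₁ : ∀ {n} → Mat n → List Carrier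
  𝒬₁ {n} M = map (quad M) (filter (λ v → lastNZ v ≟ 1#) (allVecs n))

module Submission where

-- Each step of the reduction is a congruence H ↦ Pᵀ H P by a unipotent triangular P (the row
-- operations and the same on columns), and so is replacing the top-left block by its own
-- reduction, provided the matrix is block diagonal.  Hence vᵀ 𝓡(H) v = (T v)ᵀ H (T v) where T
-- is a composite of shears v ↦ v + Φ v, with (Φ v)_i depending only on the v_j with j > i.
-- Such a T is a bijection of F^n which fixes the last nonzero entry of v, and keeps a last
-- entry 1, so it permutes the index set of each of the three multisets.
--
-- Block diagonality is where the Hankel structure enters: off the top-left ρ₁ × ρ₁ block the
-- reduced entries are values of the defect α_{j+ρ₁} - Σ_k x_k α_{j+k} of the recurrence
-- given by x, and a first nonzero defect at j ≥ ρ₁ would make H[j+1,j+1] invertible,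
-- contradicting the maximality of ρ₁.

open import Defs
open import Level using (0ℓ)
open import Function using (_∘_)
open import Data.Nat as ℕ using (ℕ; zero; suc; _<_; _≤_; z≤n; s≤s; _<?_; _≤?_; _∸_; _≡ᵇ_)
import Data.Nat.Properties as ℕP
open import Data.Nat.Induction using (<-rec)
open import Data.Fin as Fin using (Fin; zero; suc; toℕ; fromℕ<; inject≤)
import Data.Fin.Properties as FinP
import Data.Vec.Functional as V
open import Data.Bool using (true; false; if_then_else_; T)
open import Data.List using (List; []; _∷_; _++_; [_]; map; concatMap; filter; foldl; take; downFrom; length)
import Data.List.Properties as LP
open import Data.List.Relation.Binary.Permutation.Propositional
  using (_↭_; prep; swap; ↭-refl; ↭-sym; ↭-trans; ↭-reflexive; ↭⇒↭ₛ)
  renaming (refl to ↭-refl′; trans to ↭-trans′)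
open import Data.List.Relation.Binary.Permutation.Propositional.Properties
  using (++⁺ˡ; ++⁺; shift; shifts; Any-resp-↭)
open import Data.List.Relation.Binary.Permutation.Setoid.Properties using (Unique-resp-↭)
open import Data.List.Relation.Unary.Any as Any using (Any; here; there; any?)
open import Data.List.Relation.Unary.All as All using (All; []; _∷_)
import Data.List.Relation.Unary.All.Properties as AllP
open import Data.List.Relation.Unary.AllPairs as AllPairs using (AllPairs; []; _∷_)
import Data.List.Relation.Unary.AllPairs.Properties as AllPairsP
open import Data.List.Relation.Unary.Unique.Propositional using (Unique)
import Data.List.Relation.Unary.Unique.Propositional.Properties as UniqueP
open import Data.List.Membership.Propositional using (_∈_)
open import Data.List.Membership.Propositional.Properties using (∈-∃++; ∈-map⁺)
open import Data.Maybe using (just; nothing)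
open import Data.Product using (∃; _×_; _,_; proj₁; proj₂)
open import Data.Sum using (inj₁; inj₂)
open import Data.Empty using (⊥-elim)
open import Relation.Nullary using (Dec; yes; no; ¬_; does)
open import Relation.Binary using (tri<; tri≈; tri>)
open import Relation.Binary.PropositionalEquality hiding ([_])
open import Algebra.Bundles using (CommutativeRing)
import Algebra.Properties.Ring as RingProperties
import Algebra.Properties.AbelianGroup as AbelianGroupProperties
import Algebra.Properties.CommutativeSemigroup as CommutativeSemigroupProperties

module _ {A B : Set} where

  concatMap⁺ : (f : A → List B) {xs ys : List A} → xs ↭ ys → concatMap f xs ↭ concatMap f ys
  concatMap⁺ f ↭-refl′ = ↭-refl
  concatMap⁺ f (prep x p) = ++⁺ˡ (f x) (concatMap⁺ f p)
  concatMap⁺ f (swap x y p) =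
    ↭-trans (shifts (f x) (f y)) (++⁺ˡ (f y) (++⁺ˡ (f x) (concatMap⁺ f p)))
  concatMap⁺ f (↭-trans′ p q) = ↭-trans (concatMap⁺ f p) (concatMap⁺ f q)

  concatMap-cong-↭ : {f g : A → List B} → (∀ x → f x ↭ g x) → ∀ xs → concatMap f xs ↭ concatMap g xs
  concatMap-cong-↭ p [] = ↭-refl
  concatMap-cong-↭ p (x ∷ xs) = ++⁺ (p x) (concatMap-cong-↭ p xs)

  concatMap-++-distrib : (f g : A → List B) (xs : List A) →
    concatMap (λ x → f x ++ g x) xs ↭ concatMap f xs ++ concatMap g xs
  concatMap-++-distrib f g [] = ↭-refl
  concatMap-++-distrib f g (x ∷ xs) =
    ↭-trans (↭-reflexive (LP.++-assoc (f x) (g x) _))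
      (↭-trans (++⁺ˡ (f x) (++⁺ˡ (g x) (concatMap-++-distrib f g xs)))
        (↭-trans (++⁺ˡ (f x) (shifts (g x) (concatMap f xs)))
          (↭-reflexive (sym (LP.++-assoc (f x) (concatMap f xs) _)))))

  concatMap-[] : (xs : List A) → concatMap (λ _ → ([] {A = B})) xs ≡ []
  concatMap-[] [] = refl
  concatMap-[] (x ∷ xs) = concatMap-[] xs

  map-as-concatMap : (f : A → B) (xs : List A) → map f xs ≡ concatMap (λ x → [ f x ]) xs
  map-as-concatMap f xs = trans (sym (LP.concatMap-pure (map f xs))) (LP.concatMap-map [_] f xs)

map-filter-as-concatMap : ∀ {A B : Set} {P : A → Set} (P? : ∀ x → Dec (P x)) (f : A → B) xs →
  map f (filter P? xs) ≡ concatMap (λ x → if does (P? x) then [ f x ] else []) xs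
map-filter-as-concatMap P? f [] = refl
map-filter-as-concatMap P? f (x ∷ xs) with does (P? x)
... | true = cong (f x ∷_) (map-filter-as-concatMap P? f xs)
... | false = map-filter-as-concatMap P? f xs

concatMap-concatMap : {A B C : Set} (g : B → List C) (h : A → List B) (xs : List A) →
  concatMap g (concatMap h xs) ≡ concatMap (concatMap g ∘ h) xs
concatMap-concatMap g h [] = refl
concatMap-concatMap g h (x ∷ xs) =
  trans (LP.concatMap-++ g (h x) (concatMap h xs)) (cong (concatMap g (h x) ++_) (concatMap-concatMap g h xs))

concatMap-comm : {A B C : Set} (K : A → B → List C) (xs : List A) (ys : List B) →
  concatMap (λ x → concatMap (K x) ys) xs ↭ concatMap (λ y → concatMap (λ x → K x y) xs) ys
concatMap-comm {A} {B} {C} K [] ys = ↭-reflexive (sym (concatMap-[] {B} {C} ys))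
concatMap-comm K (x ∷ xs) ys =
  ↭-trans (++⁺ˡ (concatMap (K x) ys) (concatMap-comm K xs ys))
    (↭-sym (concatMap-++-distrib (K x) (λ y → concatMap (λ x′ → K x′ y) xs) ys))

Unique-⊆-⊇⇒↭ : {A : Set} {xs ys : List A} → Unique xs → Unique ys →
  (∀ {z} → z ∈ xs → z ∈ ys) → (∀ {z} → z ∈ ys → z ∈ xs) → xs ↭ ys
Unique-⊆-⊇⇒↭ {xs = []} {[]} _ _ _ _ = ↭-refl
Unique-⊆-⊇⇒↭ {xs = []} {y ∷ ys} _ _ _ ys⊆[] with ys⊆[] (here refl)
... | ()
Unique-⊆-⊇⇒↭ {xs = x ∷ xs} uxxs uys xs⊆ys ys⊆xs with ∈-∃++ (xs⊆ys (here refl))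
... | us , vs , refl = ↭-trans (prep x (Unique-⊆-⊇⇒↭ (UniqueP.drop⁺ 1 uxxs) uzs xs⊆zs zs⊆xs)) (↭-sym ys↭)
  where
  ys↭ = shift x us vs
  uxzs = Unique-resp-↭ (setoid _) (↭⇒↭ₛ ys↭) uys
  uzs = UniqueP.drop⁺ 1 uxzs
  xs⊆zs : ∀ {z} → z ∈ xs → z ∈ us ++ vs
  xs⊆zs p with Any-resp-↭ ys↭ (xs⊆ys (there p))
  ... | here refl = ⊥-elim (UniqueP.Unique[x∷xs]⇒x∉xs uxxs p)
  ... | there q = q
  zs⊆xs : ∀ {z} → z ∈ us ++ vs → z ∈ xs
  zs⊆xs p with ys⊆xs (Any-resp-↭ (↭-sym ys↭) (there p))
  ... | here refl = ⊥-elim (UniqueP.Unique[x∷xs]⇒x∉xs uxzs p)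
  ... | there q = q

module _ {A : Set} (_≈_ : A → A → Set) (≈-sym : ∀ {x y} → x ≈ y → y ≈ x)
         (≈-trans : ∀ {x y z} → x ≈ y → y ≈ z → x ≈ z) (_≈?_ : ∀ x y → Dec (x ≈ y)) where

  removeFirst : A → List A → List A
  removeFirst u [] = []
  removeFirst u (y ∷ ys) with u ≈? y
  ... | yes _ = ys
  ... | no _ = y ∷ removeFirst u ys

  length-removeFirst : ∀ u ys → Any (u ≈_) ys → suc (length (removeFirst u ys)) ≡ length ys
  length-removeFirst u (y ∷ ys) u∈ys with u ≈? y
  ... | yes _ = refl
  length-removeFirst u (y ∷ ys) (here u≈y) | no u≉y = ⊥-elim (u≉y u≈y)
  length-removeFirst u (y ∷ ys) (there u∈ys) | no _ = cong suc (length-removeFirst u ys u∈ys)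

  Any-removeFirst : ∀ u u′ ys → Any (u′ ≈_) ys → ¬ u ≈ u′ → Any (u′ ≈_) (removeFirst u ys)
  Any-removeFirst u u′ (y ∷ ys) u′∈ys u≉u′ with u ≈? y
  Any-removeFirst u u′ (y ∷ ys) (here u′≈y) u≉u′ | yes u≈y = ⊥-elim (u≉u′ (≈-trans u≈y (≈-sym u′≈y)))
  Any-removeFirst u u′ (y ∷ ys) (there u′∈ys) u≉u′ | yes _ = u′∈ys
  Any-removeFirst u u′ (y ∷ ys) (here u′≈y) u≉u′ | no _ = here u′≈y
  Any-removeFirst u u′ (y ∷ ys) (there u′∈ys) u≉u′ | no _ = there (Any-removeFirst u u′ ys u′∈ys u≉u′)

  pigeonhole : ∀ (xs ys : List A) → AllPairs (λ u v → ¬ u ≈ v) xs → All (λ u → Any (u ≈_) ys) xs →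
    length xs ≤ length ys
  pigeonhole [] ys _ _ = z≤n
  pigeonhole (u ∷ xs) ys (u≉xs ∷ distinct) (u∈ys ∷ xs⊆ys) =
    ℕP.≤-trans (s≤s (pigeonhole xs (removeFirst u ys) distinct
                       (All.zipWith (λ (u≉x , x∈ys) → Any-removeFirst u _ ys x∈ys u≉x) (u≉xs , xs⊆ys))))
               (ℕP.≤-reflexive (length-removeFirst u ys u∈ys))

All-concatMap : ∀ {A B : Set} {P : B → Set} (f : A → List B) xs → All (All P ∘ f) xs → All P (concatMap f xs)
All-concatMap f [] [] = []
All-concatMap f (x ∷ xs) (fx ∷ fxs) = AllP.++⁺ fx (All-concatMap f xs fxs)

module _ (F : FiniteField) where
  open FiniteField F
  open FF F
  open ≡-Reasoning

  private
    ring : CommutativeRing 0ℓ 0ℓ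
    ring = record { isCommutativeRing = isCommutativeRing }

  open CommutativeRing ring
    using (+-assoc; +-identityˡ; +-identityʳ; *-assoc; *-comm; *-identityˡ;
           distribˡ; distribʳ; zeroˡ; zeroʳ; -‿inverseʳ)
  open RingProperties (CommutativeRing.ring ring)
    using (-‿distribˡ-*; -‿distribʳ-*; -‿+-comm; -0#≈0#)
  open AbelianGroupProperties (CommutativeRing.+-abelianGroup ring)
    using (//-rightDividesˡ; //-rightDividesʳ; x∙y⁻¹≈ε⇒x≈y)
  open CommutativeSemigroupProperties (CommutativeRing.+-commutativeSemigroup ring)
    using () renaming (interchange to +-interchange)
  open CommutativeSemigroupProperties (CommutativeRing.*-commutativeSemigroup ring)
    using (x∙yz≈y∙xz; xy∙z≈z∙xy; xy∙z≈zy∙x)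

  +-cancelʳ : ∀ c {a b} → a + c ≡ b + c → a ≡ b
  +-cancelʳ c {a} {b} e =
    trans (sym (//-rightDividesʳ c a)) (trans (cong (_- c) e) (//-rightDividesʳ c b))

  *-distribˡ-minus : ∀ a b c → a * (b - c) ≡ a * b - a * c
  *-distribˡ-minus a b c = trans (distribˡ a b (- c)) (cong (a * b +_) (sym (-‿distribʳ-* a c)))

  *-cancel-nonzero : ∀ c y → c ≢ 0# → c * y ≡ 0# → y ≡ 0#
  *-cancel-nonzero c y c≢0 cy≡0 with inverse c c≢0
  ... | d , cd≡1 = begin
    y            ≡⟨ sym (*-identityˡ y) ⟩
    1# * y       ≡⟨ cong (_* y) (trans (sym cd≡1) (*-comm c d)) ⟩
    d * c * y    ≡⟨ *-assoc d c y ⟩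
    d * (c * y)  ≡⟨ cong (d *_) cy≡0 ⟩
    d * 0#       ≡⟨ zeroʳ d ⟩
    0#           ∎

  when : ∀ {P : Set} → Dec P → Carrier → Carrier
  when (yes _) x = x
  when (no _) x = 0#

  when-*ˡ : ∀ {P : Set} (d : Dec P) a b → a * when d b ≡ when d (a * b)
  when-*ˡ (yes _) a b = refl
  when-*ˡ (no _) a b = zeroʳ a

  when-*ʳ : ∀ {P : Set} (d : Dec P) a b → when d b * a ≡ when d (b * a)
  when-*ʳ (yes _) a b = refl
  when-*ʳ (no _) a b = zeroˡ a

  ∑ : ℕ → (ℕ → Carrier) → Carrier
  ∑ zero f = 0#
  ∑ (suc n) f = f 0 + ∑ n (f ∘ suc)

  sumF≡∑ : ∀ {n} (g : Fin n → Carrier) (f : ℕ → Carrier) → (∀ i → g i ≡ f (toℕ i)) → sumF g ≡ ∑ n f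
  sumF≡∑ {zero} g f g≡f = refl
  sumF≡∑ {suc n} g f g≡f = cong₂ _+_ (g≡f zero) (sumF≡∑ (g ∘ suc) (f ∘ suc) (g≡f ∘ suc))

  ∑-cong : ∀ n {f g : ℕ → Carrier} → (∀ i → i < n → f i ≡ g i) → ∑ n f ≡ ∑ n g
  ∑-cong zero f≡g = refl
  ∑-cong (suc n) f≡g = cong₂ _+_ (f≡g 0 (s≤s z≤n)) (∑-cong n (λ i i<n → f≡g (suc i) (s≤s i<n)))

  ∑-≡0 : ∀ n {f : ℕ → Carrier} → (∀ i → i < n → f i ≡ 0#) → ∑ n f ≡ 0#
  ∑-≡0 zero f≡0 = refl
  ∑-≡0 (suc n) f≡0 =
    trans (cong₂ _+_ (f≡0 0 (s≤s z≤n)) (∑-≡0 n (λ i i<n → f≡0 (suc i) (s≤s i<n)))) (+-identityʳ 0#)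

  ∑-+ : ∀ n (f g : ℕ → Carrier) → ∑ n (λ i → f i + g i) ≡ ∑ n f + ∑ n g
  ∑-+ zero f g = sym (+-identityʳ 0#)
  ∑-+ (suc n) f g = trans (cong (f 0 + g 0 +_) (∑-+ n _ _)) (+-interchange (f 0) (g 0) _ _)

  ∑-*ˡ : ∀ n c (f : ℕ → Carrier) → c * ∑ n f ≡ ∑ n (λ i → c * f i)
  ∑-*ˡ zero c f = zeroʳ c
  ∑-*ˡ (suc n) c f = trans (distribˡ c _ _) (cong (c * f 0 +_) (∑-*ˡ n c _))

  ∑-*ʳ : ∀ n c (f : ℕ → Carrier) → ∑ n f * c ≡ ∑ n (λ i → f i * c)
  ∑-*ʳ zero c f = zeroˡ c
  ∑-*ʳ (suc n) c f = trans (distribʳ c _ _) (cong (f 0 * c +_) (∑-*ʳ n c _))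

  ∑-neg : ∀ n (f : ℕ → Carrier) → - ∑ n f ≡ ∑ n (λ i → - f i)
  ∑-neg zero f = -0#≈0#
  ∑-neg (suc n) f = trans (sym (-‿+-comm _ _)) (cong (- f 0 +_) (∑-neg n _))

  ∑-comm : ∀ n m (f : ℕ → ℕ → Carrier) → ∑ n (λ i → ∑ m (f i)) ≡ ∑ m (λ j → ∑ n (λ i → f i j))
  ∑-comm zero m f = sym (∑-≡0 m (λ _ _ → refl))
  ∑-comm (suc n) m f = trans (cong (∑ m (f 0) +_) (∑-comm n m (f ∘ suc))) (sym (∑-+ m _ _))

  ∑-split : ∀ a b (f : ℕ → Carrier) → ∑ (a ℕ.+ b) f ≡ ∑ a f + ∑ b (λ i → f (a ℕ.+ i))
  ∑-split zero b f = sym (+-identityˡ _)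
  ∑-split (suc a) b f = trans (cong (f 0 +_) (∑-split a b _)) (sym (+-assoc _ _ _))

  ∑-δ : ∀ n c (f : ℕ → Carrier) → c < n → ∑ n (λ i → when (i ℕ.≟ c) (f i)) ≡ f c
  ∑-δ (suc n) zero f _ = trans (cong (f 0 +_) (∑-≡0 n (λ i _ → off i))) (+-identityʳ _)
    where
    off : ∀ i → when (suc i ℕ.≟ 0) (f (suc i)) ≡ 0#
    off i with suc i ℕ.≟ 0
    ... | no _ = refl
  ∑-δ (suc n) (suc c) f (s≤s c<n) =
    trans (cong (0# +_) (trans (∑-cong n (λ i _ → shifted i)) (∑-δ n c (f ∘ suc) c<n))) (+-identityˡ _)
    where
    shifted : ∀ i → when (suc i ℕ.≟ suc c) (f (suc i)) ≡ when (i ℕ.≟ c) (f (suc i))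
    shifted i with i ℕ.≟ c | suc i ℕ.≟ suc c
    ... | yes _ | yes _ = refl
    ... | no _ | no _ = refl
    ... | yes i≡c | no si≢sc = ⊥-elim (si≢sc (cong suc i≡c))
    ... | no i≢c | yes si≡sc = ⊥-elim (i≢c (ℕP.suc-injective si≡sc))

  -- Vectors are also read as zero-padded sequences on ℕ, so that index arithmetic such as
  -- a ∸ r + k stays in ℕ; matrices likewise through ent.
  pad : ∀ {n} → Vec n → ℕ → Carrier
  pad {zero} v c = 0#
  pad {suc n} v zero = v zero
  pad {suc n} v (suc c) = pad (v ∘ suc) c

  pad-toℕ : ∀ {n} (v : Vec n) i → pad v (toℕ i) ≡ v i
  pad-toℕ v zero = refl
  pad-toℕ v (suc i) = pad-toℕ (v ∘ suc) i

  pad-fromℕ< : ∀ {n} (v : Vec n) j (j<n : j < n) → pad v j ≡ v (fromℕ< j<n)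
  pad-fromℕ< v j j<n = trans (cong (pad v) (sym (FinP.toℕ-fromℕ< j<n))) (pad-toℕ v (fromℕ< j<n))

  pad-≥ : ∀ {n} (v : Vec n) c → n ≤ c → pad v c ≡ 0#
  pad-≥ {zero} v c _ = refl
  pad-≥ {suc n} v (suc c) (s≤s n≤c) = pad-≥ (v ∘ suc) c n≤c

  pad-cong : ∀ {n} {v w : Vec n} → v ≗ w → pad v ≗ pad w
  pad-cong {zero} v≗w c = refl
  pad-cong {suc n} v≗w zero = v≗w zero
  pad-cong {suc n} v≗w (suc c) = pad-cong (v≗w ∘ suc) c

  pad-zero : ∀ {n} (v : Vec n) → (∀ i → v i ≡ 0#) → ∀ c → pad v c ≡ 0#
  pad-zero {zero} v v≡0 c = refl
  pad-zero {suc n} v v≡0 zero = v≡0 zero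
  pad-zero {suc n} v v≡0 (suc c) = pad-zero (v ∘ suc) (v≡0 ∘ suc) c

  ≗-from-pad : ∀ {n} (v w : Vec n) → (∀ j → j < n → pad v j ≡ pad w j) → v ≗ w
  ≗-from-pad v w p i = trans (sym (pad-toℕ v i)) (trans (p (toℕ i) (FinP.toℕ<n i)) (pad-toℕ w i))

  -- A shear is the map v ↦ v + Φ v where entry i of Φ v depends only on the entries of v
  -- above i.  Such a map is a bijection of F^n; if moreover Φ v vanishes at i whenever v
  -- vanishes above i, it fixes the last nonzero entry of every vector.
  Perturbation : Set
  Perturbation = (ℕ → Carrier) → ℕ → Carrier

  DependsAbove : ℕ → Perturbation → Set
  DependsAbove n Φ = ∀ u u′ i → (∀ j → i < j → j < n → u j ≡ u′ j) → Φ u i ≡ Φ u′ i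

  ZeroAbove : ℕ → Perturbation → Set
  ZeroAbove n Φ = ∀ u i → (∀ j → i < j → j < n → u j ≡ 0#) → Φ u i ≡ 0#

  shear : ∀ {n} → Perturbation → Vec n → Vec n
  shear Φ v i = v i + Φ (pad v) (toℕ i)

  shear-cong : ∀ {n} Φ → DependsAbove n Φ → {v w : Vec n} → v ≗ w → shear Φ v ≗ shear Φ w
  shear-cong Φ dep v≗w i = cong₂ _+_ (v≗w i) (dep _ _ _ (λ j _ _ → pad-cong v≗w j))

  pad-shear : ∀ {n} Φ (v : Vec n) j → j < n → pad (shear Φ v) j ≡ pad v j + Φ (pad v) j
  pad-shear Φ v j j<n = trans (pad-fromℕ< (shear Φ v) j j<n)
    (cong₂ _+_ (sym (pad-fromℕ< v j j<n)) (cong (Φ (pad v)) (FinP.toℕ-fromℕ< j<n)))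

  shear-zero : ∀ {n} Φ → ZeroAbove n Φ → (w : Vec n) → (∀ i → w i ≡ 0#) → ∀ i → shear Φ w i ≡ 0#
  shear-zero Φ zero-above w w≡0 i =
    trans (cong₂ _+_ (w≡0 i) (zero-above _ _ (λ j _ _ → pad-zero w w≡0 j))) (+-identityʳ 0#)

  0∷ : (ℕ → Carrier) → ℕ → Carrier
  0∷ u zero = 0#
  0∷ u (suc c) = u c

  tailΦ : Perturbation → Perturbation
  tailΦ Φ u i = Φ (0∷ u) (suc i)

  headShift : ∀ {n} → Perturbation → Vec n → Carrier
  headShift Φ w = Φ (0∷ (pad w)) 0

  shear-∷ : ∀ {n} Φ → DependsAbove (suc n) Φ → ∀ a (w : Vec n) →
    shear Φ (a V.∷ w) ≗ (a + headShift Φ w) V.∷ shear (tailΦ Φ) w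
  shear-∷ Φ dep a w zero = cong (a +_) (dep _ _ 0 λ { (suc j) _ _ → refl })
  shear-∷ Φ dep a w (suc i) = cong (w i +_) (dep _ _ _ λ { (suc j) _ _ → refl ; zero () _ })

  tailΦ-dependsAbove : ∀ {n} Φ → DependsAbove (suc n) Φ → DependsAbove n (tailΦ Φ)
  tailΦ-dependsAbove Φ dep u u′ i p =
    dep _ _ _ λ { zero () _ ; (suc j) (s≤s i<j) (s≤s j<n) → p j i<j j<n }

  tailΦ-zeroAbove : ∀ {n} Φ → ZeroAbove (suc n) Φ → ZeroAbove n (tailΦ Φ)
  tailΦ-zeroAbove Φ zero-above u i p =
    zero-above _ _ λ { zero () _ ; (suc j) (s≤s i<j) (s≤s j<n) → p j i<j j<n }

  shear-surjective : ∀ n Φ → DependsAbove n Φ → ∀ (v : Vec n) → ∃ λ w → shear Φ w ≗ v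
  shear-surjective zero Φ dep v = v , λ ()
  shear-surjective (suc n) Φ dep v with shear-surjective n (tailΦ Φ) (tailΦ-dependsAbove Φ dep) (v ∘ suc)
  ... | w , shear-w≗ = (v zero - headShift Φ w) V.∷ w , λ i → trans (shear-∷ Φ dep _ w i) (solved i)
    where
    solved : (v zero - headShift Φ w + headShift Φ w) V.∷ shear (tailΦ Φ) w ≗ v
    solved zero = //-rightDividesˡ (headShift Φ w) (v zero)
    solved (suc i) = shear-w≗ i

  map-+-elements-↭ : ∀ c → map (_+ c) elements ↭ elements
  map-+-elements-↭ c = Unique-⊆-⊇⇒↭ (UniqueP.map⁺ (+-cancelʳ c) elements-unique) elements-unique
    (λ {z} _ → elements-complete z)
    (λ {z} _ → subst (_∈ map (_+ c) elements) (//-rightDividesˡ c z)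
                     (∈-map⁺ (_+ c) (elements-complete (z - c))))

  concatMap-translate-elements : ∀ c (K : Carrier → List Carrier) →
    concatMap (λ a → K (a + c)) elements ↭ concatMap K elements
  concatMap-translate-elements c K =
    ↭-trans (↭-reflexive (sym (LP.concatMap-map K (_+ c) elements))) (concatMap⁺ K (map-+-elements-↭ c))

  concatMap-allVecs-suc : ∀ n (G : Vec (suc n) → List Carrier) →
    concatMap G (allVecs (suc n)) ≡ concatMap (λ a → concatMap (λ w → G (a V.∷ w)) (allVecs n)) elements
  concatMap-allVecs-suc n G =
    trans (concatMap-concatMap G (λ a → map (a V.∷_) (allVecs n)) elements)
          (LP.concatMap-cong (λ a → LP.concatMap-map G (a V.∷_) (allVecs n)) elements)

  ≗-Invariant : ∀ {n} → (Vec n → List Carrier) → Set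
  ≗-Invariant {n} G = ∀ {v w : Vec n} → v ≗ w → G v ≡ G w

  -- Summing over the head first, the shear becomes a translation of the head coordinate.
  concatMap-∘-shear : ∀ n Φ → DependsAbove n Φ → (G : Vec n → List Carrier) → ≗-Invariant G →
    concatMap (G ∘ shear Φ) (allVecs n) ↭ concatMap G (allVecs n)
  concatMap-∘-shear zero Φ dep G inv = ↭-reflexive (cong (_++ []) (inv (λ ())))
  concatMap-∘-shear (suc n) Φ dep G inv =
    ↭-trans (↭-reflexive (trans (concatMap-allVecs-suc n (G ∘ shear Φ))
                                 (LP.concatMap-cong (λ a → LP.concatMap-cong (λ w → inv (shear-∷ Φ dep a w)) vs) elements)))
    (↭-trans (concatMap-comm (λ a w → G ((a + headShift Φ w) V.∷ shear Φ′ w)) elements vs)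
    (↭-trans (concatMap-cong-↭ (λ w → concatMap-translate-elements (headShift Φ w) (λ a → G (a V.∷ shear Φ′ w))) vs)
    (↭-trans (↭-sym (concatMap-comm (λ a w → G (a V.∷ shear Φ′ w)) elements vs))
    (↭-trans (concatMap-cong-↭ (λ a → concatMap-∘-shear n Φ′ (tailΦ-dependsAbove Φ dep) (G ∘ (a V.∷_)) ∷-inv) elements)
             (↭-reflexive (sym (concatMap-allVecs-suc n G)))))))
    where
    vs = allVecs n
    Φ′ = tailΦ Φ
    ∷-inv : ∀ {a} → ≗-Invariant (G ∘ (a V.∷_))
    ∷-inv v≗w = inv λ { zero → refl ; (suc i) → v≗w i }

  lastNZ-cong : ∀ {n} {v w : Vec n} → v ≗ w → lastNZ v ≡ lastNZ w
  lastNZ-cong {zero} v≗w = refl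
  lastNZ-cong {suc n} {v} {w} v≗w with lastNZ-cong {n} {v ∘ suc} {w ∘ suc} (v≗w ∘ suc)
  ... | tail≡ with lastNZ (v ∘ suc) ≟ 0# | lastNZ (w ∘ suc) ≟ 0#
  ... | yes _ | yes _ = v≗w zero
  ... | yes v≡0 | no w≢0 = ⊥-elim (w≢0 (trans (sym tail≡) v≡0))
  ... | no v≢0 | yes w≡0 = ⊥-elim (v≢0 (trans tail≡ w≡0))
  ... | no _ | no _ = tail≡

  lastNZ≡0⇒zero : ∀ {n} (v : Vec n) → lastNZ v ≡ 0# → ∀ i → v i ≡ 0#
  lastNZ≡0⇒zero {suc n} v l≡0 i with lastNZ (v ∘ suc) ≟ 0#
  lastNZ≡0⇒zero {suc n} v l≡0 zero | yes _ = l≡0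
  lastNZ≡0⇒zero {suc n} v l≡0 (suc i) | yes tail≡0 = lastNZ≡0⇒zero (v ∘ suc) tail≡0 i
  ... | no tail≢0 = ⊥-elim (tail≢0 l≡0)

  lastNZ-∷ : ∀ {n} a (w : Vec n) → lastNZ (a V.∷ w) ≡ (if does (lastNZ w ≟ 0#) then a else lastNZ w)
  lastNZ-∷ a w with lastNZ w ≟ 0#
  ... | yes _ = refl
  ... | no _ = refl

  lastNZ-shear : ∀ n Φ → DependsAbove n Φ → ZeroAbove n Φ → (v : Vec n) → lastNZ (shear Φ v) ≡ lastNZ v
  lastNZ-shear zero Φ dep zero-above v = refl
  lastNZ-shear (suc n) Φ dep zero-above v = begin
    lastNZ (shear Φ v)
      ≡⟨ lastNZ-cong (λ i → trans (shear-cong Φ dep v≗ i) (shear-∷ Φ dep (v zero) w i)) ⟩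
    lastNZ ((v zero + headShift Φ w) V.∷ shear (tailΦ Φ) w)
      ≡⟨ lastNZ-∷ _ _ ⟩
    (if does (lastNZ (shear (tailΦ Φ) w) ≟ 0#) then v zero + headShift Φ w else lastNZ (shear (tailΦ Φ) w))
      ≡⟨ step (lastNZ-shear n (tailΦ Φ) (tailΦ-dependsAbove Φ dep) (tailΦ-zeroAbove Φ zero-above) w) ⟩
    (if does (lastNZ w ≟ 0#) then v zero else lastNZ w)
      ≡⟨ sym (lastNZ-∷ (v zero) w) ⟩
    lastNZ (v zero V.∷ w)
      ≡⟨ lastNZ-cong (λ i → sym (v≗ i)) ⟩
    lastNZ v ∎
    where
    w = v ∘ suc
    v≗ : v ≗ v zero V.∷ w
    v≗ zero = refl
    v≗ (suc i) = refl
    -- if the tail is zero, so is the head shift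
    step : lastNZ (shear (tailΦ Φ) w) ≡ lastNZ w →
      (if does (lastNZ (shear (tailΦ Φ) w) ≟ 0#) then v zero + headShift Φ w else lastNZ (shear (tailΦ Φ) w))
      ≡ (if does (lastNZ w ≟ 0#) then v zero else lastNZ w)
    step tail≡ rewrite tail≡ with lastNZ w ≟ 0#
    ... | no _ = refl
    ... | yes w≡0 = trans (cong (v zero +_) (zero-above _ 0 λ { zero () _ ; (suc j) _ _ → pad-zero w (lastNZ≡0⇒zero w w≡0) j }))
                          (+-identityʳ _)

  snoc-cong : ∀ {m} {v w : Vec m} c → v ≗ w → snoc v c ≗ snoc w c
  snoc-cong {zero} c v≗w zero = refl
  snoc-cong {suc m} c v≗w zero = v≗w zero
  snoc-cong {suc m} c v≗w (suc i) = snoc-cong c (v≗w ∘ suc) i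

  putAt : ℕ → Carrier → (ℕ → Carrier) → ℕ → Carrier
  putAt zero c u zero = c
  putAt zero c u (suc j) = 0#
  putAt (suc m) c u zero = u zero
  putAt (suc m) c u (suc j) = putAt m c (u ∘ suc) j

  putAt-< : ∀ m c u j → j < m → putAt m c u j ≡ u j
  putAt-< (suc m) c u zero _ = refl
  putAt-< (suc m) c u (suc j) (s≤s j<m) = putAt-< m c (u ∘ suc) j j<m

  putAt-≡ : ∀ m c u → putAt m c u m ≡ c
  putAt-≡ zero c u = refl
  putAt-≡ (suc m) c u = putAt-≡ m c (u ∘ suc)

  pad-snoc : ∀ m (w : Vec m) c j → pad (snoc w c) j ≡ putAt m c (pad w) j
  pad-snoc zero w c zero = refl
  pad-snoc zero w c (suc j) = refl
  pad-snoc (suc m) w c zero = refl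
  pad-snoc (suc m) w c (suc j) = pad-snoc m (w ∘ suc) c j

  fixLastΦ : ℕ → Carrier → Perturbation → Perturbation
  fixLastΦ m c Φ u i = Φ (putAt m c u) i

  fixLastΦ-dependsAbove : ∀ m c Φ → DependsAbove (suc m) Φ → DependsAbove m (fixLastΦ m c Φ)
  fixLastΦ-dependsAbove m c Φ dep u u′ i agree = dep _ _ i agree′
    where
    agree′ : ∀ j → i < j → j < suc m → putAt m c u j ≡ putAt m c u′ j
    agree′ j i<j (s≤s j≤m) with ℕP.m≤n⇒m<n∨m≡n j≤m
    ... | inj₁ j<m = trans (putAt-< m c u j j<m) (trans (agree j i<j j<m) (sym (putAt-< m c u′ j j<m)))
    ... | inj₂ refl = trans (putAt-≡ m c u) (sym (putAt-≡ m c u′))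

  shear-snoc : ∀ m Φ → DependsAbove (suc m) Φ → ZeroAbove (suc m) Φ → ∀ (w : Vec m) c →
    shear Φ (snoc w c) ≗ snoc (shear (fixLastΦ m c Φ) w) c
  shear-snoc m Φ dep zero-above w c = ≗-from-pad _ _ λ j j≤m →
    trans (pad-shear Φ (snoc w c) j j≤m)
      (trans (cong₂ _+_ (pad-snoc m w c j) (dep _ _ j (λ k _ _ → pad-snoc m w c k)))
        (trans (entry j j≤m) (sym (pad-snoc m (shear (fixLastΦ m c Φ) w) c j))))
    where
    entry : ∀ j → j < suc m →
      putAt m c (pad w) j + Φ (putAt m c (pad w)) j ≡ putAt m c (pad (shear (fixLastΦ m c Φ) w)) j
    entry j (s≤s j≤m) with ℕP.m≤n⇒m<n∨m≡n j≤m
    ... | inj₁ j<m = trans (cong (_+ Φ (putAt m c (pad w)) j) (putAt-< m c (pad w) j j<m))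
                       (trans (sym (pad-shear (fixLastΦ m c Φ) w j j<m)) (sym (putAt-< m c _ j j<m)))
    ... | inj₂ refl = trans (cong₂ _+_ (putAt-≡ m c (pad w)) (zero-above _ j nothing-above))
                        (trans (+-identityʳ c) (sym (putAt-≡ m c _)))
      where
      nothing-above : ∀ k → j < k → k < suc j → putAt m c (pad w) k ≡ 0#
      nothing-above k j<k k≤j = ⊥-elim (ℕP.<⇒≱ j<k (ℕP.≤-pred k≤j))

  record Shear (n : ℕ) : Set where
    constructor mkShear
    field
      Φ : Perturbation
      dependsAbove : DependsAbove n Φ

  record Shear₀ (n : ℕ) : Set where
    constructor mkShear₀
    field
      base : Shear n
      zeroAbove : ZeroAbove n (Shear.Φ base)

  applyShears : ∀ {n} → List (Shear n) → Vec n → Vec n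
  applyShears [] v = v
  applyShears (mkShear Φ _ ∷ Ts) v = shear Φ (applyShears Ts v)

  applyShears₀ : ∀ {n} → List (Shear₀ n) → Vec n → Vec n
  applyShears₀ Ts = applyShears (map Shear₀.base Ts)

  applyShears-cong : ∀ {n} (Ts : List (Shear n)) {v w} → v ≗ w → applyShears Ts v ≗ applyShears Ts w
  applyShears-cong [] v≗w = v≗w
  applyShears-cong (mkShear Φ dep ∷ Ts) v≗w = shear-cong Φ dep (applyShears-cong Ts v≗w)

  concatMap-∘-applyShears : ∀ {n} (Ts : List (Shear n)) (G : Vec n → List Carrier) → ≗-Invariant G →
    concatMap (G ∘ applyShears Ts) (allVecs n) ↭ concatMap G (allVecs n)
  concatMap-∘-applyShears [] G inv = ↭-refl
  concatMap-∘-applyShears {n} (mkShear Φ dep ∷ Ts) G inv =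
    ↭-trans (concatMap-∘-applyShears Ts (G ∘ shear Φ) (inv ∘ shear-cong Φ dep)) (concatMap-∘-shear n Φ dep G inv)

  lastNZ-applyShears₀ : ∀ {n} (Ts : List (Shear₀ n)) v → lastNZ (applyShears₀ Ts v) ≡ lastNZ v
  lastNZ-applyShears₀ [] v = refl
  lastNZ-applyShears₀ {n} (mkShear₀ (mkShear Φ dep) zero-above ∷ Ts) v =
    trans (lastNZ-shear n Φ dep zero-above _) (lastNZ-applyShears₀ Ts v)

  fixLast : ∀ {m} → Carrier → Shear₀ (suc m) → Shear m
  fixLast {m} c (mkShear₀ (mkShear Φ dep) _) = mkShear (fixLastΦ m c Φ) (fixLastΦ-dependsAbove m c Φ dep)

  applyShears₀-snoc : ∀ {m} (Ts : List (Shear₀ (suc m))) w c →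
    applyShears₀ Ts (snoc w c) ≗ snoc (applyShears (map (fixLast c) Ts) w) c
  applyShears₀-snoc [] w c i = refl
  applyShears₀-snoc {m} (mkShear₀ (mkShear Φ dep) zero-above ∷ Ts) w c i =
    trans (shear-cong Φ dep (applyShears₀-snoc Ts w c) i) (shear-snoc m Φ dep zero-above _ c i)

  quad-cong : ∀ {n} (M : Mat n) {v w : Vec n} → v ≗ w → quad M v ≡ quad M w
  quad-cong M v≗w = sumF-cong λ i → sumF-cong λ j → cong₂ _*_ (cong (_* M i j) (v≗w i)) (v≗w j)

  module _ {n} (R M : Mat n) (Ts : List (Shear₀ n)) (quad≡ : ∀ v → quad R v ≡ quad M (applyShears₀ Ts v)) where

    𝒬-↭ : 𝒬 R ↭ 𝒬 M
    𝒬-↭ = ↭-trans (↭-reflexive (trans (map-as-concatMap (quad R) vs) (LP.concatMap-cong (cong [_] ∘ quad≡) vs)))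
      (↭-trans (concatMap-∘-applyShears (map Shear₀.base Ts) (λ v → [ quad M v ]) (cong [_] ∘ quad-cong M))
               (↭-reflexive (sym (map-as-concatMap (quad M) vs))))
      where vs = allVecs n

    𝒬₁-↭ : 𝒬₁ R ↭ 𝒬₁ M
    𝒬₁-↭ = ↭-trans (↭-reflexive (trans (map-filter-as-concatMap (λ v → lastNZ v ≟ 1#) (quad R) vs)
                      (LP.concatMap-cong (λ v → cong₂ selectUnit (sym (lastNZ-applyShears₀ Ts v)) (quad≡ v)) vs)))
      (↭-trans (concatMap-∘-applyShears (map Shear₀.base Ts) (λ v → selectUnit (lastNZ v) (quad M v))
                  (λ v≗w → cong₂ selectUnit (lastNZ-cong v≗w) (quad-cong M v≗w)))
               (↭-reflexive (sym (map-filter-as-concatMap (λ v → lastNZ v ≟ 1#) (quad M) vs))))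
      where
      vs = allVecs n
      selectUnit : Carrier → Carrier → List Carrier
      selectUnit l x = if does (l ≟ 1#) then [ x ] else []

  𝒬𝓜-↭ : ∀ {n} (R M : Mat n) (Ts : List (Shear₀ n)) → (∀ v → quad R v ≡ quad M (applyShears₀ Ts v)) →
    𝒬𝓜 R ↭ 𝒬𝓜 M
  𝒬𝓜-↭ {zero} R M Ts quad≡ = ↭-refl
  𝒬𝓜-↭ {suc m} R M Ts quad≡ =
    ↭-trans (↭-reflexive (trans (map-as-concatMap (λ w → quad R (snoc w 1#)) ws)
               (LP.concatMap-cong (λ w → cong [_] (trans (quad≡ _) (quad-cong M (applyShears₀-snoc Ts w 1#)))) ws)))
      (↭-trans (concatMap-∘-applyShears (map (fixLast 1#) Ts) (λ w → [ quad M (snoc w 1#) ])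
                  (cong [_] ∘ quad-cong M ∘ snoc-cong 1#))
               (↭-reflexive (sym (map-as-concatMap (λ w → quad M (snoc w 1#)) ws))))
    where ws = allVecs m

  VanishesFrom : ℕ → (ℕ → Carrier) → Set
  VanishesFrom n v = ∀ p → n ≤ p → v p ≡ 0#

  pad-vanishesFrom : ∀ {n} (v : Vec n) → VanishesFrom n (pad v)
  pad-vanishesFrom = pad-≥

  truncate : ℕ → (ℕ → Carrier) → ℕ → Carrier
  truncate n u c = when (c <? n) (u c)

  truncate-vanishesFrom : ∀ n u → VanishesFrom n u → ∀ c → truncate n u c ≡ u c
  truncate-vanishesFrom n u u≡0 c with c <? n
  ... | yes _ = refl
  ... | no c≮n = sym (u≡0 c (ℕP.≮⇒≥ c≮n))

  ∑-extend : ∀ n k (f : ℕ → Carrier) → VanishesFrom n f → ∑ (n ℕ.+ k) f ≡ ∑ n f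
  ∑-extend n k f f≡0 = trans (∑-split n k f)
    (trans (cong (∑ n f +_) (∑-≡0 k (λ i _ → f≡0 (n ℕ.+ i) (ℕP.m≤m+n n i)))) (+-identityʳ _))

  ∑-from : ∀ n s (g : ℕ → Carrier) → VanishesFrom n g →
    ∑ n (λ p → when (s ≤? p) (g p)) ≡ ∑ n (λ t → g (s ℕ.+ t))
  ∑-from n s g g≡0 = begin
    ∑ n h                            ≡⟨ sym (∑-extend n s h h≡0) ⟩
    ∑ (n ℕ.+ s) h                    ≡⟨ cong (λ N → ∑ N h) (ℕP.+-comm n s) ⟩
    ∑ (s ℕ.+ n) h                    ≡⟨ ∑-split s n h ⟩
    ∑ s h + ∑ n (λ t → h (s ℕ.+ t))  ≡⟨ cong₂ _+_ (∑-≡0 s below) (∑-cong n (λ t _ → above t)) ⟩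
    0# + ∑ n (λ t → g (s ℕ.+ t))     ≡⟨ +-identityˡ _ ⟩
    ∑ n (λ t → g (s ℕ.+ t))          ∎
    where
    h = λ p → when (s ≤? p) (g p)
    h≡0 : VanishesFrom n h
    h≡0 i n≤i with s ≤? i
    ... | yes _ = g≡0 i n≤i
    ... | no _ = refl
    below : ∀ i → i < s → h i ≡ 0#
    below i i<s with s ≤? i
    ... | yes s≤i = ⊥-elim (ℕP.<⇒≱ i<s s≤i)
    ... | no _ = refl
    above : ∀ t → h (s ℕ.+ t) ≡ g (s ℕ.+ t)
    above t with s ≤? s ℕ.+ t
    ... | yes _ = refl
    ... | no s≰s+t = ⊥-elim (s≰s+t (ℕP.m≤m+n s t))

  rowReduce : ℕ → (ℕ → Carrier) → (ℕ → ℕ → Carrier) → ℕ → ℕ → Carrier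
  rowReduce r x m p q = m p q - when (r ≤? p) (∑ r (λ k → x k * m (p ∸ r ℕ.+ k) q))

  colReduce : ℕ → (ℕ → Carrier) → (ℕ → ℕ → Carrier) → ℕ → ℕ → Carrier
  colReduce r x m p q = rowReduce r x (λ a b → m b a) q p

  -- rowReduce is left multiplication by a lower unitriangular matrix P; transposing P turns
  -- it into the shear v ↦ v + reduceΦ v.
  reduceΦ : ℕ → ℕ → (ℕ → Carrier) → Perturbation
  reduceΦ n r x u a = - ∑ r (λ k → when (k ≤? a) (x k * truncate n u (a ℕ.+ r ∸ k)))

  reduceφ : ℕ → ℕ → (ℕ → Carrier) → (ℕ → Carrier) → ℕ → Carrier
  reduceφ n r x u a = u a + reduceΦ n r x u a

  bilinear : ℕ → (ℕ → ℕ → Carrier) → (ℕ → Carrier) → (ℕ → Carrier) → Carrier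
  bilinear n m v w = ∑ n (λ p → ∑ n (λ q → v p * m p q * w q))

  bilinear-cong : ∀ n {m m′ : ℕ → ℕ → Carrier} {v v′ w w′ : ℕ → Carrier} →
    (∀ p q → p < n → q < n → m p q ≡ m′ p q) → (∀ p → p < n → v p ≡ v′ p) → (∀ p → p < n → w p ≡ w′ p) →
    bilinear n m v w ≡ bilinear n m′ v′ w′
  bilinear-cong n m≡ v≡ w≡ =
    ∑-cong n (λ p p<n → ∑-cong n (λ q q<n → cong₂ _*_ (cong₂ _*_ (v≡ p p<n) (m≡ p q p<n q<n)) (w≡ q q<n)))

  crossTerm : ℕ → ℕ → (ℕ → Carrier) → (ℕ → Carrier) → (ℕ → Carrier) → Carrier
  crossTerm n r x v c = ∑ r (λ k → x k * ∑ n (λ t → v (r ℕ.+ t) * c (k ℕ.+ t)))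

  crossTerm-rows : ∀ n r x (v c : ℕ → Carrier) → VanishesFrom n v →
    ∑ n (λ p → v p * when (r ≤? p) (∑ r (λ k → x k * c (p ∸ r ℕ.+ k)))) ≡ crossTerm n r x v c
  crossTerm-rows n r x v c v≡0 = begin
    ∑ n (λ p → v p * when (r ≤? p) (∑ r (λ k → x k * c (p ∸ r ℕ.+ k))))
      ≡⟨ ∑-cong n (λ p _ → trans (when-*ˡ (r ≤? p) _ _) (inside p)) ⟩
    ∑ n (λ p → ∑ r (λ k → x k * when (r ≤? p) (v p * c (p ∸ r ℕ.+ k))))
      ≡⟨ ∑-comm n r _ ⟩
    ∑ r (λ k → ∑ n (λ p → x k * when (r ≤? p) (v p * c (p ∸ r ℕ.+ k))))
      ≡⟨ ∑-cong r (λ k _ → sym (∑-*ˡ n (x k) _)) ⟩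
    ∑ r (λ k → x k * ∑ n (λ p → when (r ≤? p) (v p * c (p ∸ r ℕ.+ k))))
      ≡⟨ ∑-cong r (λ k _ → cong (x k *_) (∑-from n r _ (λ p n≤p → trans (cong (_* _) (v≡0 p n≤p)) (zeroˡ _)))) ⟩
    ∑ r (λ k → x k * ∑ n (λ t → v (r ℕ.+ t) * c (r ℕ.+ t ∸ r ℕ.+ k)))
      ≡⟨ ∑-cong r (λ k _ → cong (x k *_) (∑-cong n (λ t _ → cong (λ i → v (r ℕ.+ t) * c i)
           (trans (cong (ℕ._+ k) (ℕP.m+n∸m≡n r t)) (ℕP.+-comm t k))))) ⟩
    crossTerm n r x v c ∎
    where
    inside : ∀ p → when (r ≤? p) (v p * ∑ r (λ k → x k * c (p ∸ r ℕ.+ k))) ≡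
                   ∑ r (λ k → x k * when (r ≤? p) (v p * c (p ∸ r ℕ.+ k)))
    inside p with r ≤? p
    ... | yes _ = trans (∑-*ˡ r (v p) _) (∑-cong r (λ k _ → x∙yz≈y∙xz (v p) (x k) _))
    ... | no _ = sym (∑-≡0 r (λ k _ → zeroʳ (x k)))

  crossTerm-cols : ∀ n r x (v c : ℕ → Carrier) → VanishesFrom n v → VanishesFrom n c →
    ∑ n (λ a → ∑ r (λ k → when (k ≤? a) (x k * truncate n v (a ℕ.+ r ∸ k))) * c a) ≡ crossTerm n r x v c
  crossTerm-cols n r x v c v≡0 c≡0 = begin
    ∑ n (λ a → ∑ r (λ k → when (k ≤? a) (x k * truncate n v (a ℕ.+ r ∸ k))) * c a)
      ≡⟨ ∑-cong n (λ a _ → trans (∑-*ʳ r (c a) _) (∑-cong r (λ k _ → inside a k))) ⟩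
    ∑ n (λ a → ∑ r (λ k → x k * when (k ≤? a) (truncate n v (a ℕ.+ r ∸ k) * c a)))
      ≡⟨ ∑-comm n r _ ⟩
    ∑ r (λ k → ∑ n (λ a → x k * when (k ≤? a) (truncate n v (a ℕ.+ r ∸ k) * c a)))
      ≡⟨ ∑-cong r (λ k _ → sym (∑-*ˡ n (x k) _)) ⟩
    ∑ r (λ k → x k * ∑ n (λ a → when (k ≤? a) (truncate n v (a ℕ.+ r ∸ k) * c a)))
      ≡⟨ ∑-cong r (λ k _ → cong (x k *_) (∑-from n k _ (λ p n≤p → trans (cong (_ *_) (c≡0 p n≤p)) (zeroʳ _)))) ⟩
    ∑ r (λ k → x k * ∑ n (λ t → truncate n v (k ℕ.+ t ℕ.+ r ∸ k) * c (k ℕ.+ t)))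
      ≡⟨ ∑-cong r (λ k _ → cong (x k *_) (∑-cong n (λ t _ → cong (_* c (k ℕ.+ t))
           (trans (truncate-vanishesFrom n v v≡0 _) (cong v (index k t)))))) ⟩
    crossTerm n r x v c ∎
    where
    index : ∀ k t → k ℕ.+ t ℕ.+ r ∸ k ≡ r ℕ.+ t
    index k t = trans (cong (_∸ k) (ℕP.+-assoc k t r)) (trans (ℕP.m+n∸m≡n k (t ℕ.+ r)) (ℕP.+-comm t r))
    inside : ∀ a k → when (k ≤? a) (x k * truncate n v (a ℕ.+ r ∸ k)) * c a ≡
                     x k * when (k ≤? a) (truncate n v (a ℕ.+ r ∸ k) * c a)
    inside a k with k ≤? a
    ... | yes _ = *-assoc _ _ _
    ... | no _ = trans (zeroˡ (c a)) (sym (zeroʳ (x k)))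

  rowReduce-adjoint : ∀ n r x (v c : ℕ → Carrier) → VanishesFrom n v → VanishesFrom n c →
    ∑ n (λ p → v p * (c p - when (r ≤? p) (∑ r (λ k → x k * c (p ∸ r ℕ.+ k)))))
    ≡ ∑ n (λ a → reduceφ n r x v a * c a)
  rowReduce-adjoint n r x v c v≡0 c≡0 = begin
    ∑ n (λ p → v p * (c p - when (r ≤? p) (∑ r (λ k → x k * c (p ∸ r ℕ.+ k)))))
      ≡⟨ ∑-cong n (λ p _ → *-distribˡ-minus (v p) (c p) _) ⟩
    ∑ n (λ p → v p * c p - v p * when (r ≤? p) (∑ r (λ k → x k * c (p ∸ r ℕ.+ k))))
      ≡⟨ trans (∑-+ n _ _) (cong (vc +_) (sym (∑-neg n _))) ⟩
    vc - ∑ n (λ p → v p * when (r ≤? p) (∑ r (λ k → x k * c (p ∸ r ℕ.+ k))))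
      ≡⟨ cong (λ t → vc - t) (trans (crossTerm-rows n r x v c v≡0) (sym (crossTerm-cols n r x v c v≡0 c≡0))) ⟩
    vc - ∑ n (λ a → ∑ r (λ k → when (k ≤? a) (x k * truncate n v (a ℕ.+ r ∸ k))) * c a)
      ≡⟨ cong (vc +_) (trans (∑-neg n _) (∑-cong n (λ a _ → -‿distribˡ-* _ _))) ⟩
    vc + ∑ n (λ a → reduceΦ n r x v a * c a)
      ≡⟨ sym (∑-+ n _ _) ⟩
    ∑ n (λ a → v a * c a + reduceΦ n r x v a * c a)
      ≡⟨ ∑-cong n (λ a _ → sym (distribʳ (c a) (v a) _)) ⟩
    ∑ n (λ a → reduceφ n r x v a * c a) ∎
    where vc = ∑ n (λ p → v p * c p)

  bilinear-by-columns : ∀ n m (v w : ℕ → Carrier) → bilinear n m v w ≡ ∑ n (λ q → ∑ n (λ p → v p * m p q) * w q)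
  bilinear-by-columns n m v w = trans (∑-comm n n _) (∑-cong n (λ q _ → sym (∑-*ʳ n (w q) _)))

  bilinear-by-rows : ∀ n m (v w : ℕ → Carrier) → bilinear n m v w ≡ ∑ n (λ p → v p * ∑ n (λ q → m p q * w q))
  bilinear-by-rows n m v w =
    ∑-cong n (λ p _ → trans (∑-cong n (λ q _ → *-assoc (v p) (m p q) (w q))) (sym (∑-*ˡ n (v p) _)))

  bilinear-transpose : ∀ n m (v w : ℕ → Carrier) → bilinear n (λ a b → m b a) v w ≡ bilinear n m w v
  bilinear-transpose n m v w =
    trans (∑-comm n n _) (∑-cong n (λ p _ → ∑-cong n (λ q _ → xy∙z≈zy∙x (v q) (m p q) (w p))))

  bilinear-rowReduce : ∀ n r x m (v w : ℕ → Carrier) → VanishesFrom n v → (∀ p q → n ≤ p → m p q ≡ 0#) →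
    bilinear n (rowReduce r x m) v w ≡ bilinear n m (reduceφ n r x v) w
  bilinear-rowReduce n r x m v w v≡0 m≡0 = trans (bilinear-by-columns n _ v w)
    (trans (∑-cong n (λ q _ → cong (_* w q) (rowReduce-adjoint n r x v (λ p → m p q) v≡0 (λ p n≤p → m≡0 p q n≤p))))
           (sym (bilinear-by-columns n m _ w)))

  bilinear-colReduce : ∀ n r x m (v w : ℕ → Carrier) → VanishesFrom n w → (∀ p q → n ≤ q → m p q ≡ 0#) →
    bilinear n (colReduce r x m) v w ≡ bilinear n m v (reduceφ n r x w)
  bilinear-colReduce n r x m v w w≡0 m≡0 = trans (bilinear-transpose n (rowReduce r x (λ a b → m b a)) v w)
    (trans (bilinear-rowReduce n r x (λ a b → m b a) w v w≡0 (λ p q n≤p → m≡0 q p n≤p))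
           (bilinear-transpose n m (reduceφ n r x w) v))

  rowReduce-vanishesFrom-col : ∀ n r x m → (∀ p q → n ≤ q → m p q ≡ 0#) →
    ∀ p q → n ≤ q → rowReduce r x m p q ≡ 0#
  rowReduce-vanishesFrom-col n r x m m≡0 p q n≤q =
    trans (cong₂ _-_ (m≡0 p q n≤q) (subtracted (r ≤? p))) (trans (+-identityˡ _) -0#≈0#)
    where
    subtracted : ∀ {P} (d : Dec P) → when d (∑ r (λ k → x k * m (p ∸ r ℕ.+ k) q)) ≡ 0#
    subtracted (yes _) = ∑-≡0 r (λ k _ → trans (cong (x k *_) (m≡0 _ q n≤q)) (zeroʳ _))
    subtracted (no _) = refl

  bilinear-reduce : ∀ n r x m (v : ℕ → Carrier) → VanishesFrom n v →
    (∀ p q → n ≤ p → m p q ≡ 0#) → (∀ p q → n ≤ q → m p q ≡ 0#) →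
    bilinear n (colReduce r x (rowReduce r x m)) v v ≡ bilinear n m (reduceφ n r x v) (reduceφ n r x v)
  bilinear-reduce n r x m v v≡0 rows≡0 cols≡0 =
    trans (bilinear-colReduce n r x (rowReduce r x m) v v v≡0 (rowReduce-vanishesFrom-col n r x m cols≡0))
          (bilinear-rowReduce n r x m v _ v≡0 rows≡0)

  ent-fromℕ< : ∀ {n} (M : Mat n) a b (a<n : a < n) (b<n : b < n) → ent M a b ≡ M (fromℕ< a<n) (fromℕ< b<n)
  ent-fromℕ< {n} M a b a<n b<n with a <? n | b <? n
  ... | yes _ | yes _ = refl
  ... | no a≮n | _ = ⊥-elim (a≮n a<n)
  ... | yes _ | no b≮n = ⊥-elim (b≮n b<n)

  ent-toℕ : ∀ {n} (M : Mat n) i j → ent M (toℕ i) (toℕ j) ≡ M i j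
  ent-toℕ M i j = trans (ent-fromℕ< M _ _ (FinP.toℕ<n i) (FinP.toℕ<n j))
    (cong₂ M (FinP.fromℕ<-toℕ i _) (FinP.fromℕ<-toℕ j _))

  ent-row-≥ : ∀ {n} (M : Mat n) a b → n ≤ a → ent M a b ≡ 0#
  ent-row-≥ {n} M a b n≤a with a <? n
  ... | yes a<n = ⊥-elim (ℕP.<⇒≱ a<n n≤a)
  ... | no _ = refl

  ent-col-≥ : ∀ {n} (M : Mat n) a b → n ≤ b → ent M a b ≡ 0#
  ent-col-≥ {n} M a b n≤b with a <? n | b <? n
  ... | yes _ | yes b<n = ⊥-elim (ℕP.<⇒≱ b<n n≤b)
  ... | yes _ | no _ = refl
  ... | no _ | _ = refl

  ent-cong : ∀ {n} {M M′ : Mat n} → M ≐ M′ → ∀ a b → ent M a b ≡ ent M′ a b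
  ent-cong {n} M≐M′ a b with a <? n | b <? n
  ... | yes _ | yes _ = M≐M′ _ _
  ... | yes _ | no _ = refl
  ... | no _ | _ = refl

  quad≡bilinear : ∀ {n} (M : Mat n) (v : Vec n) → quad M v ≡ bilinear n (ent M) (pad v) (pad v)
  quad≡bilinear M v = sumF≡∑ _ _ λ i → sumF≡∑ _ _ λ j →
    sym (cong₂ _*_ (cong₂ _*_ (pad-toℕ v i) (ent-toℕ M i j)) (pad-toℕ v j))

  zeroAbove-from-dependsAbove : ∀ n Φ → DependsAbove n Φ → (∀ i → Φ (λ _ → 0#) i ≡ 0#) → ZeroAbove n Φ
  zeroAbove-from-dependsAbove n Φ dep Φ0≡0 u i u≡0 = trans (dep u _ i u≡0) (Φ0≡0 i)

  reduceΦ-dependsAbove : ∀ n r x → DependsAbove n (reduceΦ n r x)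
  reduceΦ-dependsAbove n r x u u′ a agree = cong -_ (∑-cong r λ k k<r → term k k<r (k ≤? a))
    where
    term : ∀ k → k < r → (d : Dec (k ≤ a)) →
      when d (x k * truncate n u (a ℕ.+ r ∸ k)) ≡ when d (x k * truncate n u′ (a ℕ.+ r ∸ k))
    term k k<r (no _) = refl
    term k k<r (yes _) = cong (x k *_) (entry (a ℕ.+ r ∸ k <? n))
      where
      above : a < a ℕ.+ r ∸ k
      above = subst (a <_) (sym (ℕP.+-∸-assoc a (ℕP.<⇒≤ k<r))) (ℕP.m<m+n a (ℕP.m<n⇒0<n∸m k<r))
      entry : (d : Dec (a ℕ.+ r ∸ k < n)) → when d (u (a ℕ.+ r ∸ k)) ≡ when d (u′ (a ℕ.+ r ∸ k))
      entry (yes below-n) = agree _ above below-n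
      entry (no _) = refl

  reduceΦ-zeroAbove : ∀ n r x → ZeroAbove n (reduceΦ n r x)
  reduceΦ-zeroAbove n r x = zeroAbove-from-dependsAbove n _ (reduceΦ-dependsAbove n r x) λ a →
    trans (cong -_ (∑-≡0 r (λ k _ → term k (k ≤? a) (a ℕ.+ r ∸ k <? n)))) -0#≈0#
    where
    term : ∀ {P Q : Set} k (d : Dec P) (e : Dec Q) → when d (x k * when e 0#) ≡ 0#
    term k (no _) _ = refl
    term k (yes _) (no _) = zeroʳ (x k)
    term k (yes _) (yes _) = zeroʳ (x k)

  reduceShear : ∀ n r x → Shear₀ n
  reduceShear n r x = mkShear₀ (mkShear (reduceΦ n r x) (reduceΦ-dependsAbove n r x)) (reduceΦ-zeroAbove n r x)

  quad-shear-reduceΦ : ∀ {n} r x (M : Mat n) (v : Vec n) →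
    quad M (shear (reduceΦ n r x) v) ≡ bilinear n (ent M) (reduceφ n r x (pad v)) (reduceφ n r x (pad v))
  quad-shear-reduceΦ {n} r x M v = trans (quad≡bilinear M _) (bilinear-cong n (λ _ _ _ _ → refl) pad≡ pad≡)
    where pad≡ = λ p p<n → pad-shear (reduceΦ n r x) v p p<n

  rowReduce-< : ∀ r x m a b → a < r → rowReduce r x m a b ≡ m a b
  rowReduce-< r x m a b a<r with r ≤? a
  ... | yes r≤a = ⊥-elim (ℕP.<⇒≱ a<r r≤a)
  ... | no _ = trans (cong (m a b +_) -0#≈0#) (+-identityʳ _)

  rowReduce-≥ : ∀ r x m a b → r ≤ a → rowReduce r x m a b ≡ m a b - ∑ r (λ k → x k * m (a ∸ r ℕ.+ k) b)
  rowReduce-≥ r x m a b r≤a with r ≤? a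
  ... | yes _ = refl
  ... | no r≰a = ⊥-elim (r≰a r≤a)

  shifted-index< : ∀ {r a k n} → r ≤ a → k < r → a < n → a ∸ r ℕ.+ k < n
  shifted-index< {r} {a} {k} r≤a k<r a<n =
    ℕP.<-≤-trans (ℕP.+-monoʳ-< (a ∸ r) k<r) (ℕP.≤-trans (ℕP.≤-reflexive (ℕP.m∸n+n≡m r≤a)) (ℕP.<⇒≤ a<n))

  if-T : ∀ {A : Set} {b} {x y : A} → T b → (if b then x else y) ≡ x
  if-T {b = true} _ = refl

  if-¬T : ∀ {A : Set} {b} {x y : A} → ¬ T b → (if b then x else y) ≡ y
  if-¬T {b = true} ¬t = ⊥-elim (¬t _)
  if-¬T {b = false} _ = refl

  ent-rowOp-≡ : ∀ {n r} (x : Vec r) (M : Mat n) a b → a < n → b < n →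
    ent (rowOp x M a) a b ≡ ent M a b - ∑ r (λ k → pad x k * ent M (a ∸ r ℕ.+ k) b)
  ent-rowOp-≡ {n} {r} x M a b a<n b<n = trans (ent-fromℕ< _ a b a<n b<n)
    (trans (if-T (ℕP.≡⇒≡ᵇ _ a (FinP.toℕ-fromℕ< a<n)))
      (cong₂ _-_ (sym (ent-fromℕ< M a b a<n b<n))
        (sumF≡∑ _ _ λ k → cong₂ _*_ (sym (pad-toℕ x k))
             (cong (ent M (a ∸ r ℕ.+ toℕ k)) (FinP.toℕ-fromℕ< b<n)))))

  ent-rowOp-≢ : ∀ {n r} (x : Vec r) (M : Mat n) i a b → a < n → b < n → a ≢ i →
    ent (rowOp x M i) a b ≡ ent M a b
  ent-rowOp-≢ x M i a b a<n b<n a≢i = trans (ent-fromℕ< _ a b a<n b<n)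
    (trans (if-¬T λ t → a≢i (trans (sym (FinP.toℕ-fromℕ< a<n)) (ℕP.≡ᵇ⇒≡ (toℕ (fromℕ< a<n)) i t)))
           (sym (ent-fromℕ< M a b a<n b<n)))

  -- Rows are processed from the bottom up, so each operation only reads rows still equal to M₀.
  ent-foldl-rowOp : ∀ {n r} (x : Vec r) (M₀ : Mat n) d (M : Mat n) →
    (∀ a b → a < n → b < n → r ℕ.+ d ≤ a → ent M a b ≡ rowReduce r (pad x) (ent M₀) a b) →
    (∀ a b → a < n → b < n → a < r ℕ.+ d → ent M a b ≡ ent M₀ a b) →
    ∀ a b → a < n → b < n →
    ent (foldl (rowOp x) M (take d (downFrom (r ℕ.+ d)))) a b ≡ rowReduce r (pad x) (ent M₀) a b
  ent-foldl-rowOp {n} {r} x M₀ zero M done untouched a b a<n b<n = byRow (r ≤? a)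
    where
    byRow : Dec (r ≤ a) → ent M a b ≡ rowReduce r (pad x) (ent M₀) a b
    byRow (yes r≤a) = done a b a<n b<n (subst (_≤ a) (sym (ℕP.+-identityʳ r)) r≤a)
    byRow (no r≰a) = trans (untouched a b a<n b<n (subst (a <_) (sym (ℕP.+-identityʳ r)) (ℕP.≰⇒> r≰a)))
                           (sym (rowReduce-< r (pad x) (ent M₀) a b (ℕP.≰⇒> r≰a)))
  ent-foldl-rowOp {n} {r} x M₀ (suc d) M done untouched a b a<n b<n =
    trans (cong (λ N → ent (foldl (rowOp x) M (take (suc d) (downFrom N))) a b) (ℕP.+-suc r d))
      (ent-foldl-rowOp x M₀ d (rowOp x M i) done′ untouched′ a b a<n b<n)
    where
    i = r ℕ.+ d
    read< : ∀ k → k < r → i ∸ r ℕ.+ k < suc i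
    read< k k<r = s≤s (subst (λ t → t ℕ.+ k ≤ i) (sym (ℕP.m+n∸m≡n r d))
                         (subst (d ℕ.+ k ≤_) (ℕP.+-comm d r) (ℕP.+-monoʳ-≤ d (ℕP.<⇒≤ k<r))))
    done′ : ∀ a b → a < n → b < n → i ≤ a → ent (rowOp x M i) a b ≡ rowReduce r (pad x) (ent M₀) a b
    done′ a b a<n b<n i≤a with a ℕ.≟ i
    ... | yes refl = trans (ent-rowOp-≡ x M a b a<n b<n)
        (trans (cong₂ _-_ (untouched a b a<n b<n (subst (a <_) (sym (ℕP.+-suc r d)) (ℕP.n<1+n a)))
                  (∑-cong r λ k k<r → cong (pad x k *_)
                    (untouched _ b (shifted-index< (ℕP.m≤m+n r d) k<r a<n) b<n
                      (subst (i ∸ r ℕ.+ k <_) (sym (ℕP.+-suc r d)) (read< k k<r)))))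
          (sym (rowReduce-≥ r (pad x) (ent M₀) a b (ℕP.m≤m+n r d))))
    ... | no a≢i = trans (ent-rowOp-≢ x M _ a b a<n b<n a≢i)
        (done a b a<n b<n (subst (_≤ a) (sym (ℕP.+-suc r d)) (ℕP.≤∧≢⇒< i≤a (a≢i ∘ sym))))
    untouched′ : ∀ a b → a < n → b < n → a < i → ent (rowOp x M i) a b ≡ ent M₀ a b
    untouched′ a b a<n b<n a<i = trans (ent-rowOp-≢ x M _ a b a<n b<n (ℕP.<⇒≢ a<i))
        (untouched a b a<n b<n (ℕP.<-trans a<i (subst (i <_) (sym (ℕP.+-suc r d)) (ℕP.n<1+n i))))

  ent-rowOps : ∀ {n r} (x : Vec r) (M : Mat n) → r ≤ n → ∀ a b → a < n → b < n →
    ent (rowOps x M) a b ≡ rowReduce r (pad x) (ent M) a b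
  ent-rowOps {n} {r} x M r≤n =
    subst (λ N → ∀ a b → a < n → b < n →
                   ent (foldl (rowOp x) M (take (n ∸ r) (downFrom N))) a b ≡ rowReduce r (pad x) (ent M) a b)
          (ℕP.m+[n∸m]≡n r≤n)
          (ent-foldl-rowOp x M (n ∸ r) M nothing-done (λ _ _ _ _ _ → refl))
    where
    nothing-done : ∀ a b → a < n → b < n → r ℕ.+ (n ∸ r) ≤ a → ent M a b ≡ rowReduce r (pad x) (ent M) a b
    nothing-done a b a<n _ n≤a = ⊥-elim (ℕP.<⇒≱ a<n (subst (_≤ a) (ℕP.m+[n∸m]≡n r≤n) n≤a))

  transpose : ∀ {n} → Mat n → Mat n
  transpose M i j = M j i

  ent-transpose : ∀ {n} (M : Mat n) a b → ent (transpose M) a b ≡ ent M b a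
  ent-transpose {n} M a b with a <? n | b <? n
  ... | yes _ | yes _ = refl
  ... | yes _ | no _ = refl
  ... | no _ | yes _ = refl
  ... | no _ | no _ = refl

  rowOp-cong : ∀ {n r} (x : Vec r) {M M′ : Mat n} → M ≐ M′ → ∀ i → rowOp x M i ≐ rowOp x M′ i
  rowOp-cong x M≐M′ i p j with toℕ p ≡ᵇ i
  ... | true = cong₂ _-_ (M≐M′ p j) (sumF-cong λ k → cong (x k *_) (ent-cong M≐M′ _ _))
  ... | false = M≐M′ p j

  colOp-transpose : ∀ {n r} (x : Vec r) (M : Mat n) j → colOp x M j ≐ transpose (rowOp x (transpose M) j)
  colOp-transpose x M j p q with toℕ q ≡ᵇ j
  ... | true = cong (λ t → M p q - t) (sumF-cong λ k → cong (x k *_) (sym (ent-transpose M _ _)))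
  ... | false = refl

  foldl-colOp-transpose : ∀ {n r} (x : Vec r) is (N N′ : Mat n) → transpose N ≐ N′ →
    foldl (colOp x) N is ≐ transpose (foldl (rowOp x) N′ is)
  foldl-colOp-transpose x [] N N′ Nᵀ≐N′ p q = Nᵀ≐N′ q p
  foldl-colOp-transpose x (i ∷ is) N N′ Nᵀ≐N′ = foldl-colOp-transpose x is (colOp x N i) (rowOp x N′ i)
    λ p q → trans (colOp-transpose x N i q p) (rowOp-cong x Nᵀ≐N′ i p q)

  rowReduce-cong : ∀ {n} r x (m m′ : ℕ → ℕ → Carrier) → (∀ a b → a < n → b < n → m a b ≡ m′ a b) →
    ∀ a b → a < n → b < n → rowReduce r x m a b ≡ rowReduce r x m′ a b
  rowReduce-cong r x m m′ m≡m′ a b a<n b<n = cong₂ _-_ (m≡m′ a b a<n b<n) (subtracted (r ≤? a))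
    where
    subtracted : (d : Dec (r ≤ a)) →
      when d (∑ r (λ k → x k * m (a ∸ r ℕ.+ k) b)) ≡ when d (∑ r (λ k → x k * m′ (a ∸ r ℕ.+ k) b))
    subtracted (yes r≤a) = ∑-cong r λ k k<r → cong (x k *_) (m≡m′ _ b (shifted-index< r≤a k<r a<n) b<n)
    subtracted (no _) = refl

  ent-colOps : ∀ {n r} (x : Vec r) (N : Mat n) → r ≤ n → ∀ a b → a < n → b < n →
    ent (colOps x N) a b ≡ colReduce r (pad x) (ent N) a b
  ent-colOps {n} {r} x N r≤n a b a<n b<n =
    trans (ent-cong (foldl-colOp-transpose x (opIndices n r) N (transpose N) (λ _ _ → refl)) a b)
    (trans (ent-transpose (rowOps x (transpose N)) a b)
    (trans (ent-rowOps x (transpose N) r≤n b a b<n a<n)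
    (rowReduce-cong r (pad x) _ (λ a b → ent N b a) (λ a b _ _ → ent-transpose N a b) b a b<n a<n)))

  ent-colOps-rowOps : ∀ {n r} (x : Vec r) (M : Mat n) → r ≤ n → ∀ a b → a < n → b < n →
    ent (colOps x (rowOps x M)) a b ≡ colReduce r (pad x) (rowReduce r (pad x) (ent M)) a b
  ent-colOps-rowOps {n} {r} x M r≤n a b a<n b<n = trans (ent-colOps x (rowOps x M) r≤n a b a<n b<n)
    (rowReduce-cong r (pad x) (λ a′ b′ → ent (rowOps x M) b′ a′) (λ a′ b′ → rowReduce r (pad x) (ent M) b′ a′)
                    (λ a′ b′ a′<n b′<n → ent-rowOps x M r≤n b′ a′ b′<n a′<n) b a b<n a<n)

  quad-colOps-rowOps : ∀ {n r} (x : Vec r) (M : Mat n) → r ≤ n → ∀ (v : Vec n) →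
    quad (colOps x (rowOps x M)) v ≡ quad M (shear (reduceΦ n r (pad x)) v)
  quad-colOps-rowOps {n} {r} x M r≤n v = trans (quad≡bilinear _ v)
    (trans (bilinear-cong n (ent-colOps-rowOps x M r≤n) (λ _ _ → refl) (λ _ _ → refl))
    (trans (bilinear-reduce n r (pad x) (ent M) (pad v) (pad-vanishesFrom v) (ent-row-≥ M) (ent-col-≥ M))
    (sym (quad-shear-reduceΦ r (pad x) M v))))

  sumF-≡0 : ∀ {n} (f : Fin n → Carrier) → (∀ i → f i ≡ 0#) → sumF f ≡ 0#
  sumF-≡0 {zero} f f≡0 = refl
  sumF-≡0 {suc n} f f≡0 = trans (cong₂ _+_ (f≡0 zero) (sumF-≡0 (f ∘ suc) (f≡0 ∘ suc))) (+-identityʳ 0#)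

  sumF-+ : ∀ {n} (f g : Fin n → Carrier) → sumF (λ i → f i + g i) ≡ sumF f + sumF g
  sumF-+ {zero} f g = sym (+-identityʳ 0#)
  sumF-+ {suc n} f g = trans (cong (f zero + g zero +_) (sumF-+ (f ∘ suc) (g ∘ suc))) (+-interchange (f zero) (g zero) _ _)

  sumF-*ˡ : ∀ {n} c (f : Fin n → Carrier) → c * sumF f ≡ sumF (λ i → c * f i)
  sumF-*ˡ {zero} c f = zeroʳ c
  sumF-*ˡ {suc n} c f = trans (distribˡ c _ _) (cong (c * f zero +_) (sumF-*ˡ c (f ∘ suc)))

  sumF-*ʳ : ∀ {n} c (f : Fin n → Carrier) → sumF f * c ≡ sumF (λ i → f i * c)
  sumF-*ʳ {zero} c f = zeroˡ c
  sumF-*ʳ {suc n} c f = trans (distribʳ c _ _) (cong (f zero * c +_) (sumF-*ʳ c (f ∘ suc)))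

  sumF-neg : ∀ {n} (f : Fin n → Carrier) → - sumF f ≡ sumF (λ i → - f i)
  sumF-neg {zero} f = -0#≈0#
  sumF-neg {suc n} f = trans (sym (-‿+-comm _ _)) (cong (- f zero +_) (sumF-neg (f ∘ suc)))

  sumF-comm : ∀ {n m} (f : Fin n → Fin m → Carrier) → sumF (λ i → sumF (f i)) ≡ sumF (λ j → sumF (λ i → f i j))
  sumF-comm {zero} {m} f = sym (sumF-≡0 {m} (λ _ → 0#) (λ _ → refl))
  sumF-comm {suc n} f =
    trans (cong (sumF (f zero) +_) (sumF-comm (f ∘ suc))) (sym (sumF-+ (f zero) (λ j → sumF (λ i → f (suc i) j))))

  I-≡ : ∀ {n} (i : Fin n) → I i i ≡ 1#
  I-≡ i with i Fin.≟ i
  ... | yes _ = refl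
  ... | no i≢i = ⊥-elim (i≢i refl)

  I-≢ : ∀ {n} (i j : Fin n) → i ≢ j → I i j ≡ 0#
  I-≢ i j i≢j with i Fin.≟ j
  ... | yes i≡j = ⊥-elim (i≢j i≡j)
  ... | no _ = refl

  I-suc : ∀ {n} (i l : Fin n) → I (suc i) (suc l) ≡ I i l
  I-suc i l = byCases (i Fin.≟ l)
    where
    byCases : Dec (i ≡ l) → I (suc i) (suc l) ≡ I i l
    byCases (yes refl) = trans (I-≡ (suc i)) (sym (I-≡ i))
    byCases (no i≢l) = trans (I-≢ (suc i) (suc l) (i≢l ∘ FinP.suc-injective)) (sym (I-≢ i l i≢l))

  I-sym : ∀ {n} (i j : Fin n) → I i j ≡ I j i
  I-sym i j = byCases (i Fin.≟ j)
    where
    byCases : Dec (i ≡ j) → I i j ≡ I j i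
    byCases (yes refl) = refl
    byCases (no i≢j) = trans (I-≢ i j i≢j) (sym (I-≢ j i (i≢j ∘ sym)))

  sumF-I-* : ∀ {n} (i : Fin n) (c : Fin n → Carrier) → sumF (λ l → I i l * c l) ≡ c i
  sumF-I-* {suc n} zero c = trans (cong₂ _+_ (*-identityˡ (c zero)) (sumF-≡0 _ λ l → zeroˡ (c (suc l)))) (+-identityʳ _)
  sumF-I-* {suc n} (suc i) c =
    trans (cong₂ _+_ (zeroˡ (c zero)) (trans (sumF-cong λ l → cong (_* c (suc l)) (I-suc i l)) (sumF-I-* i (c ∘ suc))))
          (+-identityˡ _)

  sumF-*-I : ∀ {n} (j : Fin n) (c : Fin n → Carrier) → sumF (λ l → c l * I l j) ≡ c j
  sumF-*-I j c = trans (sumF-cong λ l → trans (*-comm _ _) (cong (_* c l) (I-sym l j))) (sumF-I-* j c)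

  infixr 7 _·ᵥ_
  _·ᵥ_ : ∀ {k} → Mat k → Vec k → Vec k
  (A ·ᵥ v) i = sumF (λ j → A i j * v j)

  ·ᵥ-assoc : ∀ {k} (A B : Mat k) (c : Vec k) → A ·ᵥ B ·ᵥ c ≗ (A · B) ·ᵥ c
  ·ᵥ-assoc A B c i = begin
    sumF (λ l → A i l * sumF (λ m → B l m * c m))    ≡⟨ sumF-cong (λ l → sumF-*ˡ (A i l) (λ m → B l m * c m)) ⟩
    sumF (λ l → sumF (λ m → A i l * (B l m * c m)))  ≡⟨ sumF-comm (λ l m → A i l * (B l m * c m)) ⟩
    sumF (λ m → sumF (λ l → A i l * (B l m * c m)))  ≡⟨ sumF-cong (λ m → sumF-cong (λ l → sym (*-assoc (A i l) (B l m) (c m)))) ⟩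
    sumF (λ m → sumF (λ l → A i l * B l m * c m))    ≡⟨ sumF-cong (λ m → sym (sumF-*ʳ (c m) (λ l → A i l * B l m))) ⟩
    sumF (λ m → (A · B) i m * c m)                    ∎

  ·ᵥ-distrib-minus : ∀ {k} (A : Mat k) (u v : Vec k) i → (A ·ᵥ (λ j → u j - v j)) i ≡ (A ·ᵥ u) i - (A ·ᵥ v) i
  ·ᵥ-distrib-minus A u v i = trans (sumF-cong (λ j → *-distribˡ-minus (A i j) (u j) (v j)))
    (trans (sumF-+ (λ j → A i j * u j) (λ j → - (A i j * v j))) (cong ((A ·ᵥ u) i +_) (sym (sumF-neg (λ j → A i j * v j)))))

  TrivialKernel : ∀ {k} → Mat k → Set
  TrivialKernel {k} A = ∀ v → (∀ i → (A ·ᵥ v) i ≡ 0#) → ∀ i → v i ≡ 0#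

  trivialKernel⇒injective : ∀ {k} (A : Mat k) → TrivialKernel A → ∀ u v → A ·ᵥ u ≗ A ·ᵥ v → u ≗ v
  trivialKernel⇒injective A ker u v Au≗Av i = x∙y⁻¹≈ε⇒x≈y (u i) (v i) (ker (λ j → u j - v j) A[u-v]≡0 i)
    where
    A[u-v]≡0 : ∀ j → (A ·ᵥ (λ j → u j - v j)) j ≡ 0#
    A[u-v]≡0 j = trans (·ᵥ-distrib-minus A u v j) (trans (cong (λ t → (A ·ᵥ u) j - t) (sym (Au≗Av j))) (-‿inverseʳ _))

  _≗?_ : ∀ {k} (u v : Vec k) → Dec (u ≗ v)
  u ≗? v = FinP.all? (λ i → u i ≟ v i)

  allVecs-distinct : ∀ k → AllPairs (λ u v → ¬ u ≗ v) (allVecs k)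
  allVecs-distinct zero = [] ∷ []
  allVecs-distinct (suc k) = go elements elements-unique
    where
    vs = allVecs k
    go : ∀ as → Unique as → AllPairs (λ u v → ¬ u ≗ v) (concatMap (λ a → map (a V.∷_) vs) as)
    go [] _ = []
    go (a ∷ as) (a∉as ∷ unique) = AllPairsP.++⁺
      (AllPairsP.map⁺ (AllPairs.map (λ v≉w v∷≗w∷ → v≉w (v∷≗w∷ ∘ suc)) (allVecs-distinct k)))
      (go as unique)
      (AllP.map⁺ (All.tabulate λ _ → All-concatMap _ as
        (All.map (λ a≢b → AllP.map⁺ (All.tabulate (λ _ heads≡ → a≢b (heads≡ zero)))) a∉as)))

  allVecs-complete : ∀ {k} (v : Vec k) → Any (v ≗_) (allVecs k)
  allVecs-complete {k} v = allFuns-complete _≡_ elements elements-complete k v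

  trivialKernel⇒surjective : ∀ {k} (A : Mat k) → TrivialKernel A → ∀ (y : Vec k) → ∃ λ v → A ·ᵥ v ≗ y
  trivialKernel⇒surjective {k} A ker y with any? (λ v → (A ·ᵥ v) ≗? y) (allVecs k)
  ... | yes hit = Any.satisfied hit
  ... | no miss = ⊥-elim (ℕP.<-irrefl refl too-many)
    where
    vs = allVecs k
    image = map (A ·ᵥ_) vs
    distinct : AllPairs (λ u v → ¬ u ≗ v) (y ∷ image)
    distinct = AllP.map⁺ (All.map (λ y≉Av y≗Av → y≉Av (sym ∘ y≗Av)) (AllP.¬Any⇒All¬ _ miss))
             ∷ AllPairsP.map⁺ (AllPairs.map (λ {u} {v} u≉v Au≗Av → u≉v (trivialKernel⇒injective A ker u v Au≗Av))
                                            (allVecs-distinct k))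
    too-many : suc (length vs) ≤ length vs
    too-many = subst (λ ℓ → suc ℓ ≤ length vs) (LP.length-map (A ·ᵥ_) vs)
      (pigeonhole _≗_ (λ p → sym ∘ p) (λ p q i → trans (p i) (q i)) _≗?_
                  (y ∷ image) vs distinct (All.tabulate (λ {u} _ → allVecs-complete u)))

  trivialKernel⇒invertible : ∀ {k} (A : Mat k) → TrivialKernel A → Invertible A
  trivialKernel⇒invertible {k} A ker = B , AB≐I , BA≐I
    where
    column : Fin k → Vec k
    column j i = I i j
    B : Mat k
    B i j = proj₁ (trivialKernel⇒surjective A ker (column j)) i
    AB≐I : (A · B) ≐ I
    AB≐I i j = proj₂ (trivialKernel⇒surjective A ker (column j)) i
    BA≐I : (B · A) ≐ I
    BA≐I i j = trivialKernel⇒injective A ker (B ·ᵥ Aj) (column j) A[BAj]≗Aj i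
      where
      Aj : Vec k
      Aj l = A l j
      A[BAj]≗Aj : A ·ᵥ B ·ᵥ Aj ≗ A ·ᵥ column j
      A[BAj]≗Aj i′ = trans (·ᵥ-assoc A B Aj i′) (trans (sumF-cong (λ l → cong (_* Aj l) (AB≐I i′ l)))
                       (trans (sumF-I-* i′ Aj) (sym (sumF-*-I j (A i′)))))

  ∑-single : ∀ s t (f : ℕ → Carrier) → t < s → (∀ i → i < s → i ≢ t → f i ≡ 0#) → ∑ s f ≡ f t
  ∑-single s t f t<s f≡0 = trans (∑-cong s (λ i i<s → term i i<s (i ℕ.≟ t))) (∑-δ s t f t<s)
    where
    term : ∀ i → i < s → (d : Dec (i ≡ t)) → f i ≡ when d (f i)
    term i i<s (yes _) = refl
    term i i<s (no i≢t) = f≡0 i i<s i≢t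

  unitSeq : ℕ → ℕ → Carrier
  unitSeq a p = when (p ℕ.≟ a) 1#

  ∑-unitSeq-* : ∀ k i (f : ℕ → Carrier) → i < k → ∑ k (λ l → unitSeq i l * f l) ≡ f i
  ∑-unitSeq-* k i f i<k =
    trans (∑-cong k (λ l _ → trans (when-*ʳ (l ℕ.≟ i) (f l) 1#) (cong (when (l ℕ.≟ i)) (*-identityˡ (f l)))))
          (∑-δ k i f i<k)

  unitSeq-vanishesFrom : ∀ k a → a < k → VanishesFrom k (unitSeq a)
  unitSeq-vanishesFrom k a a<k p k≤p with p ℕ.≟ a
  ... | yes refl = ⊥-elim (ℕP.<⇒≱ a<k k≤p)
  ... | no _ = refl

  bilinear-unitSeq : ∀ k m (w : ℕ → Carrier) a → a < k → bilinear k m (unitSeq a) w ≡ ∑ k (λ q → m a q * w q)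
  bilinear-unitSeq k m w a a<k =
    trans (bilinear-by-rows k m (unitSeq a) w) (∑-unitSeq-* k a (λ p → ∑ k (λ q → m p q * w q)) a<k)

  -- Solve for y (s-1), y (s-2), … using rows 0, 1, ….
  antidiagonal-kernel : ∀ s (T : ℕ → ℕ → Carrier) (y : ℕ → Carrier) c → c ≢ 0# →
    (∀ i t → suc (i ℕ.+ t) < s → T i t ≡ 0#) → (∀ i t → suc (i ℕ.+ t) ≡ s → T i t ≡ c) →
    (∀ i → i < s → ∑ s (λ t → T i t * y t) ≡ 0#) → ∀ t → t < s → y t ≡ 0#
  antidiagonal-kernel s T y c c≢0 T-above T-anti rows t₀ t₀<s =
    <-rec (λ i → ∀ t → i ℕ.+ suc t ≡ s → y t ≡ 0#) solve (s ∸ suc t₀) t₀ (ℕP.m∸n+n≡m t₀<s)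
    where
    solve : ∀ i → (∀ {i′} → i′ < i → ∀ t → i′ ℕ.+ suc t ≡ s → y t ≡ 0#) →
            ∀ t → i ℕ.+ suc t ≡ s → y t ≡ 0#
    solve i earlier t i+1+t≡s =
      *-cancel-nonzero c (y t) c≢0 (trans (cong (_* y t) (sym (T-anti i t anti)))
        (trans (sym (∑-single s t _ t<s off-t)) (rows i i<s)))
      where
      anti : suc (i ℕ.+ t) ≡ s
      anti = trans (sym (ℕP.+-suc i t)) i+1+t≡s
      t<s : t < s
      t<s = subst (t <_) i+1+t≡s (ℕP.m≤n+m (suc t) i)
      i<s : i < s
      i<s = subst (i <_) i+1+t≡s (ℕP.m<m+n i (s≤s z≤n))
      off-t : ∀ t′ → t′ < s → t′ ≢ t → T i t′ * y t′ ≡ 0#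
      off-t t′ t′<s t′≢t with ℕP.<-cmp t′ t
      ... | tri< t′<t _ _ =
        trans (cong (_* y t′) (T-above i t′ (subst (suc (i ℕ.+ t′) <_) anti (s≤s (ℕP.+-monoʳ-< i t′<t))))) (zeroˡ _)
      ... | tri≈ _ t′≡t _ = ⊥-elim (t′≢t t′≡t)
      ... | tri> _ _ t<t′ = trans (cong (T i t′ *_) (earlier smaller t′ (ℕP.m∸n+n≡m t′<s))) (zeroʳ _)
        where
        smaller : s ∸ suc t′ < i
        smaller = ℕP.+-cancelʳ-< (suc t′) _ _ (subst (_< i ℕ.+ suc t′) (sym (ℕP.m∸n+n≡m t′<s))
                    (subst (_< i ℕ.+ suc t′) i+1+t≡s (ℕP.+-monoʳ-< i (s≤s t<t′))))

  ent-·ᵥ : ∀ {k} (A : Mat k) (v : Vec k) a (a<k : a < k) → (A ·ᵥ v) (fromℕ< a<k) ≡ ∑ k (λ q → ent A a q * pad v q)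
  ent-·ᵥ A v a a<k = sumF≡∑ _ _ λ l →
    sym (cong₂ _*_ (trans (ent-fromℕ< A a (toℕ l) a<k (FinP.toℕ<n l)) (cong (A _) (FinP.fromℕ<-toℕ l _)))
                   (pad-toℕ v l))

  ent-· : ∀ {k} (A B : Mat k) a b → a < k → b < k → ent (A · B) a b ≡ ∑ k (λ l → ent A a l * ent B l b)
  ent-· A B a b a<k b<k = trans (ent-fromℕ< (A · B) a b a<k b<k) (sumF≡∑ _ _ λ l → sym (cong₂ _*_
    (trans (ent-fromℕ< A a (toℕ l) a<k (FinP.toℕ<n l)) (cong (A _) (FinP.fromℕ<-toℕ l _)))
    (trans (ent-fromℕ< B (toℕ l) b (FinP.toℕ<n l) b<k) (cong (λ i → B i _) (FinP.fromℕ<-toℕ l _)))))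

  ent-sub : ∀ {r n} (r≤n : r ≤ n) (M : Mat n) a b → a < r → b < r → ent (sub r≤n M) a b ≡ ent M a b
  ent-sub r≤n M a b a<r b<r = trans (ent-fromℕ< (sub r≤n M) a b a<r b<r)
    (trans (sym (ent-toℕ M _ _)) (cong₂ (ent M)
       (trans (FinP.toℕ-inject≤ _ r≤n) (FinP.toℕ-fromℕ< a<r))
       (trans (FinP.toℕ-inject≤ _ r≤n) (FinP.toℕ-fromℕ< b<r))))

  ent-I : ∀ {k} a b → a < k → b < k → ent (I {k}) a b ≡ unitSeq a b
  ent-I {k} a b a<k b<k = trans (ent-fromℕ< I a b a<k b<k) (byCases (b ℕ.≟ a))
    where
    byCases : (d : Dec (b ≡ a)) → I (fromℕ< a<k) (fromℕ< b<k) ≡ when d 1#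
    byCases (yes refl) = I-≡ (fromℕ< a<k)
    byCases (no b≢a) = I-≢ _ _ λ e →
      b≢a (sym (trans (sym (FinP.toℕ-fromℕ< a<k)) (trans (cong toℕ e) (FinP.toℕ-fromℕ< b<k))))

  colReduce-rowReduce-< : ∀ r x m a b → a < r → b < r → colReduce r x (rowReduce r x m) a b ≡ m a b
  colReduce-rowReduce-< r x m a b a<r b<r =
    trans (rowReduce-< r x (λ a′ b′ → rowReduce r x m b′ a′) b a b<r) (rowReduce-< r x m a b a<r)

  -- Testing the reduced matrix against unit vectors moves the reduction onto w and the unit
  -- vector, and the shear undoes the first of these.
  reduced-kernel : ∀ {n} r x (M : Mat n) (v w : Vec n) → (∀ i → (M ·ᵥ v) i ≡ 0#) →
    shear (reduceΦ n r x) w ≗ v →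
    ∀ a → a < n → ∑ n (λ b → colReduce r x (rowReduce r x (ent M)) a b * pad w b) ≡ 0#
  reduced-kernel {n} r x M v w Mv≡0 shear-w≗v a a<n = begin
    ∑ n (λ b → colReduce r x (rowReduce r x (ent M)) a b * pad w b)
      ≡⟨ sym (bilinear-unitSeq n _ (pad w) a a<n) ⟩
    bilinear n (colReduce r x (rowReduce r x (ent M))) (unitSeq a) (pad w)
      ≡⟨ bilinear-colReduce n r x _ (unitSeq a) (pad w) (pad-vanishesFrom w)
           (rowReduce-vanishesFrom-col n r x (ent M) (ent-col-≥ M)) ⟩
    bilinear n (rowReduce r x (ent M)) (unitSeq a) (reduceφ n r x (pad w))
      ≡⟨ bilinear-rowReduce n r x (ent M) (unitSeq a) _ (unitSeq-vanishesFrom n a a<n) (ent-row-≥ M) ⟩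
    bilinear n (ent M) (reduceφ n r x (unitSeq a)) (reduceφ n r x (pad w))
      ≡⟨ bilinear-cong n (λ _ _ _ _ → refl) (λ _ _ → refl) φw≡v ⟩
    bilinear n (ent M) (reduceφ n r x (unitSeq a)) (pad v)
      ≡⟨ bilinear-by-rows n (ent M) _ (pad v) ⟩
    ∑ n (λ p → reduceφ n r x (unitSeq a) p * ∑ n (λ q → ent M p q * pad v q))
      ≡⟨ ∑-≡0 n (λ p p<n → trans (cong (_ *_) (trans (sym (ent-·ᵥ M v p p<n)) (Mv≡0 _))) (zeroʳ _)) ⟩
    0# ∎
    where
    φw≡v : ∀ q → q < n → reduceφ n r x (pad w) q ≡ pad v q
    φw≡v q q<n = trans (sym (pad-shear (reduceΦ n r x) w q q<n)) (pad-cong shear-w≗v q)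

  ent-hankel : ∀ {n} (M : Mat n) → IsHankel M → ∀ a b a′ b′ → a < n → b < n → a′ < n → b′ < n →
    a ℕ.+ b ≡ a′ ℕ.+ b′ → ent M a b ≡ ent M a′ b′
  ent-hankel M hank a b a′ b′ a<n b<n a′<n b′<n sum≡ = trans (ent-fromℕ< M a b a<n b<n) (trans
    (hank _ _ _ _ (trans (cong₂ ℕ._+_ (FinP.toℕ-fromℕ< a<n) (FinP.toℕ-fromℕ< b<n))
                  (trans sum≡ (sym (cong₂ ℕ._+_ (FinP.toℕ-fromℕ< a′<n) (FinP.toℕ-fromℕ< b′<n))))))
    (sym (ent-fromℕ< M a′ b′ a′<n b′<n)))

  hankelSeq : ∀ {n} → Mat n → ℕ → Carrier
  hankelSeq {n} M s with s ≤? ℕ.pred n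
  ... | yes _ = ent M 0 s
  ... | no _ = ent M (s ∸ ℕ.pred n) (ℕ.pred n)

  ent≡hankelSeq : ∀ {n} (M : Mat n) → IsHankel M → ∀ a b → a < n → b < n → ent M a b ≡ hankelSeq M (a ℕ.+ b)
  ent≡hankelSeq {suc n} M hank a b a<n b<n with a ℕ.+ b ≤? n
  ... | yes a+b≤n = ent-hankel M hank a b 0 (a ℕ.+ b) a<n b<n (s≤s z≤n) (s≤s a+b≤n) refl
  ... | no a+b≰n = ent-hankel M hank a b (a ℕ.+ b ∸ n) n a<n b<n row<n (ℕP.n<1+n n)
                     (sym (ℕP.m∸n+n≡m (ℕP.<⇒≤ (ℕP.≰⇒> a+b≰n))))
    where
    row<n : a ℕ.+ b ∸ n < suc n
    row<n = s≤s (subst (a ℕ.+ b ∸ n ≤_) (ℕP.m+n∸n≡m n n)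
                  (ℕP.∸-monoˡ-≤ n (ℕP.+-mono-≤ (ℕP.≤-pred a<n) (ℕP.≤-pred b<n))))

  -- x solves H[r,r] x = (α_r, …, α_{2r-1}); the reduction replaces the entries outside the
  -- top-left block by values of the defect of the recurrence α_{j+r} = Σ_k x_k α_{j+k}.
  module Reduction {n} (M : Mat n) (hank : IsHankel M) (r : ℕ) (r<n : r < n) (B : Mat r)
               (inv : IsInverse (sub (ℕP.<⇒≤ r<n) M) B) where

    r≤n : r ≤ n
    r≤n = ℕP.<⇒≤ r<n

    x : ℕ → Carrier
    x = pad (solveX M r<n B)

    α : ℕ → Carrier
    α = hankelSeq M

    defect : ℕ → Carrier
    defect j = α (j ℕ.+ r) - ∑ r (λ k → x k * α (j ℕ.+ k))

    m≡α : ∀ a b → a < n → b < n → ent M a b ≡ α (a ℕ.+ b)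
    m≡α = ent≡hankelSeq M hank

    module ReducedEntries (N : ℕ) (m : ℕ → ℕ → Carrier)
                          (m≡α : ∀ a b → a < N → b < N → m a b ≡ α (a ℕ.+ b)) where

      rowReduce-defect : ∀ a b → r ≤ a → a < N → b < N → rowReduce r x m a b ≡ defect (a ∸ r ℕ.+ b)
      rowReduce-defect a b r≤a a<N b<N = trans (rowReduce-≥ r x m a b r≤a)
        (cong₂ _-_ (trans (m≡α a b a<N b<N) (cong α (sym shift-r)))
          (∑-cong r λ k k<r → cong (x k *_) (trans (m≡α _ b (shifted-index< r≤a k<r a<N) b<N) (cong α (swap-k k)))))
        where
        shift-r : a ∸ r ℕ.+ b ℕ.+ r ≡ a ℕ.+ b
        shift-r = trans (ℕP.+-assoc (a ∸ r) b r) (trans (cong (a ∸ r ℕ.+_) (ℕP.+-comm b r))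
                  (trans (sym (ℕP.+-assoc (a ∸ r) r b)) (cong (ℕ._+ b) (ℕP.m∸n+n≡m r≤a))))
        swap-k : ∀ k → a ∸ r ℕ.+ k ℕ.+ b ≡ a ∸ r ℕ.+ b ℕ.+ k
        swap-k k = trans (ℕP.+-assoc (a ∸ r) k b) (trans (cong (a ∸ r ℕ.+_) (ℕP.+-comm k b)) (sym (ℕP.+-assoc (a ∸ r) b k)))

      private
        D : ℕ → ℕ → Carrier
        D = colReduce r x (rowReduce r x m)

      reduced-upper : ∀ a b → a < r → r ≤ b → b < N → D a b ≡ defect (a ℕ.+ (b ∸ r))
      reduced-upper a b a<r r≤b b<N = trans (rowReduce-≥ r x (λ a′ b′ → rowReduce r x m b′ a′) b a r≤b)
        (cong₂ _-_ (trans (rowReduce-< r x m a b a<r) (trans (m≡α a b a<N b<N) (cong α (sym shift-r))))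
          (∑-cong r λ k k<r → cong (x k *_) (trans (rowReduce-< r x m a (b ∸ r ℕ.+ k) a<r)
             (trans (m≡α a (b ∸ r ℕ.+ k) a<N (shifted-index< r≤b k<r b<N)) (cong α (sym (ℕP.+-assoc a (b ∸ r) k)))))))
        where
        a<N = ℕP.<-≤-trans a<r (ℕP.≤-trans r≤b (ℕP.<⇒≤ b<N))
        shift-r : a ℕ.+ (b ∸ r) ℕ.+ r ≡ a ℕ.+ b
        shift-r = trans (ℕP.+-assoc a (b ∸ r) r) (cong (a ℕ.+_) (ℕP.m∸n+n≡m r≤b))

      reduced-lower : ∀ a b → r ≤ a → a < N → b < r → D a b ≡ defect (a ∸ r ℕ.+ b)
      reduced-lower a b r≤a a<N b<r =
        trans (rowReduce-< r x (λ a′ b′ → rowReduce r x m b′ a′) b a b<r) (rowReduce-defect a b r≤a a<N b<N)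
        where b<N = ℕP.<-≤-trans b<r (ℕP.≤-trans r≤a (ℕP.<⇒≤ a<N))

      reduced-corner : ∀ a b → r ≤ a → a < N → r ≤ b → b < N →
        D a b ≡ defect (a ∸ r ℕ.+ b) - ∑ r (λ k → x k * defect (a ∸ r ℕ.+ (b ∸ r ℕ.+ k)))
      reduced-corner a b r≤a a<N r≤b b<N = trans (rowReduce-≥ r x (λ a′ b′ → rowReduce r x m b′ a′) b a r≤b)
        (cong₂ _-_ (rowReduce-defect a b r≤a a<N b<N)
          (∑-cong r λ k k<r → cong (x k *_) (rowReduce-defect a (b ∸ r ℕ.+ k) r≤a a<N (shifted-index< r≤b k<r b<N))))

    x≡B·column : ∀ k → k < r → x k ≡ ∑ r (λ l → ent B k l * ent M l r)
    x≡B·column k k<r = trans (pad-fromℕ< (solveX M r<n B) k k<r) (sumF≡∑ _ _ λ l → cong₂ _*_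
      (sym (trans (ent-fromℕ< B k (toℕ l) k<r (FinP.toℕ<n l)) (cong (B _) (FinP.fromℕ<-toℕ l _))))
      (trans (sym (ent-toℕ M _ _)) (cong₂ (ent M) (FinP.toℕ-inject≤ l r≤n) (FinP.toℕ-fromℕ< r<n))))

    H·B≡I : ∀ i j → i < r → j < r → ∑ r (λ l → ent M i l * ent B l j) ≡ unitSeq i j
    H·B≡I i j i<r j<r = trans (sym (∑-cong r λ l l<r → cong (_* ent B l j) (ent-sub r≤n M i l i<r l<r)))
      (trans (sym (ent-· _ B i j i<r j<r)) (trans (ent-cong (proj₁ inv) i j) (ent-I i j i<r j<r)))

    B·H≡I : ∀ i j → i < r → j < r → ∑ r (λ l → ent B i l * ent M l j) ≡ unitSeq i j
    B·H≡I i j i<r j<r = trans (sym (∑-cong r λ l l<r → cong (ent B i l *_) (ent-sub r≤n M l j l<r j<r)))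
      (trans (sym (ent-· B _ i j i<r j<r)) (trans (ent-cong (proj₂ inv) i j) (ent-I i j i<r j<r)))

    defect-< : ∀ j → j < r → defect j ≡ 0#
    defect-< j j<r = trans (cong₂ _-_ (sym (m≡α j r j<n r<n)) recurrence) (-‿inverseʳ _)
      where
      j<n = ℕP.<-trans j<r r<n
      m = ent M
      recurrence : ∑ r (λ k → x k * α (j ℕ.+ k)) ≡ m j r
      recurrence = begin
        ∑ r (λ k → x k * α (j ℕ.+ k))
          ≡⟨ ∑-cong r (λ k k<r → cong₂ _*_ (x≡B·column k k<r) (sym (m≡α j k j<n (ℕP.<-trans k<r r<n)))) ⟩
        ∑ r (λ k → ∑ r (λ l → ent B k l * m l r) * m j k)
          ≡⟨ ∑-cong r (λ k _ → trans (∑-*ʳ r (m j k) _) (∑-cong r λ l _ → xy∙z≈z∙xy (ent B k l) (m l r) (m j k))) ⟩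
        ∑ r (λ k → ∑ r (λ l → m j k * (ent B k l * m l r)))
          ≡⟨ ∑-comm r r _ ⟩
        ∑ r (λ l → ∑ r (λ k → m j k * (ent B k l * m l r)))
          ≡⟨ ∑-cong r (λ l _ → trans (∑-cong r (λ k _ → sym (*-assoc (m j k) (ent B k l) (m l r)))) (sym (∑-*ʳ r (m l r) _))) ⟩
        ∑ r (λ l → ∑ r (λ k → m j k * ent B k l) * m l r)
          ≡⟨ ∑-cong r (λ l l<r → cong (_* m l r) (H·B≡I j l j<r l<r)) ⟩
        ∑ r (λ l → unitSeq j l * m l r)
          ≡⟨ ∑-unitSeq-* r j (λ l → m l r) j<r ⟩
        m j r ∎

    -- If the defect first fails to vanish at j ≥ r, the reduction of H[j+1,j+1] is block
    -- diagonal: H[r,r] and a block with zeros above its antidiagonal and defect j on it.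
    -- Both blocks are nonsingular, hence so is H[j+1,j+1].
    module FirstDefect (j : ℕ) (r≤j : r ≤ j) (j<n : suc j < n)
                       (earlier : ∀ j′ → j′ < j → defect j′ ≡ 0#) (defect≢0 : defect j ≢ 0#) where

      k≤n : suc j ≤ n
      k≤n = ℕP.<⇒≤ j<n

      H : Mat (suc j)
      H = sub k≤n M

      open ReducedEntries (suc j) (ent H) (λ a b a<k b<k →
        trans (ent-sub k≤n M a b a<k b<k) (m≡α a b (ℕP.<-trans a<k j<n) (ℕP.<-trans b<k j<n)))

      D : ℕ → ℕ → Carrier
      D = colReduce r x (rowReduce r x (ent H))

      s : ℕ
      s = suc j ∸ r

      r+s≡k : r ℕ.+ s ≡ suc j
      r+s≡k = ℕP.m+[n∸m]≡n (ℕP.≤-trans r≤j (ℕP.n≤1+n j))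

      in-k : ∀ {a} → a < r → a < suc j
      in-k a<r = ℕP.<-≤-trans a<r (ℕP.≤-trans r≤j (ℕP.n≤1+n j))

      r+t<k : ∀ t → t < s → r ℕ.+ t < suc j
      r+t<k t t<s = subst (r ℕ.+ t <_) r+s≡k (ℕP.+-monoʳ-< r t<s)

      ∑-split-at-r : ∀ (f : ℕ → Carrier) → ∑ (suc j) f ≡ ∑ r f + ∑ s (λ t → f (r ℕ.+ t))
      ∑-split-at-r f = trans (cong (λ K → ∑ K f) (sym r+s≡k)) (∑-split r s f)

      topLeft : ∀ a b → a < r → b < r → D a b ≡ ent M a b
      topLeft a b a<r b<r =
        trans (colReduce-rowReduce-< r x (ent H) a b a<r b<r) (ent-sub k≤n M a b (in-k a<r) (in-k b<r))

      topRight : ∀ a t → a < r → t < s → D a (r ℕ.+ t) ≡ 0#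
      topRight a t a<r t<s = trans (reduced-upper a (r ℕ.+ t) a<r (ℕP.m≤m+n r t) (r+t<k t t<s))
        (trans (cong (λ i → defect (a ℕ.+ i)) (ℕP.m+n∸m≡n r t))
               (earlier _ (ℕP.≤-pred (ℕP.≤-trans (s≤s (ℕP.+-monoˡ-≤ t a<r)) (r+t<k t t<s)))))

      corner : ∀ i t → i < s → t < s → r ℕ.+ (i ℕ.+ t) ≤ j → D (r ℕ.+ i) (r ℕ.+ t) ≡ defect (r ℕ.+ (i ℕ.+ t))
      corner i t i<s t<s bound =
        trans (reduced-corner (r ℕ.+ i) (r ℕ.+ t) (ℕP.m≤m+n r i) (r+t<k i i<s) (ℕP.m≤m+n r t) (r+t<k t t<s))
          (trans (cong₂ _-_ (cong defect diagonal) (∑-≡0 r λ l l<r → trans (cong (x l *_) (lower l l<r)) (zeroʳ _)))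
                 (trans (cong (defect (r ℕ.+ (i ℕ.+ t)) +_) -0#≈0#) (+-identityʳ _)))
        where
        diagonal : r ℕ.+ i ∸ r ℕ.+ (r ℕ.+ t) ≡ r ℕ.+ (i ℕ.+ t)
        diagonal = trans (cong (ℕ._+ (r ℕ.+ t)) (ℕP.m+n∸m≡n r i))
          (trans (sym (ℕP.+-assoc i r t)) (trans (cong (ℕ._+ t) (ℕP.+-comm i r)) (ℕP.+-assoc r i t)))
        lower : ∀ l → l < r → defect (r ℕ.+ i ∸ r ℕ.+ (r ℕ.+ t ∸ r ℕ.+ l)) ≡ 0#
        lower l l<r = trans (cong defect (trans (cong₂ ℕ._+_ (ℕP.m+n∸m≡n r i) (cong (ℕ._+ l) (ℕP.m+n∸m≡n r t)))
                                               (sym (ℕP.+-assoc i t l))))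
          (earlier _ (ℕP.<-≤-trans (subst (i ℕ.+ t ℕ.+ l <_) (ℕP.+-comm (i ℕ.+ t) r) (ℕP.+-monoʳ-< (i ℕ.+ t) l<r)) bound))

      summands<s : ∀ {i t} → suc (i ℕ.+ t) ≤ s → i < s × t < s
      summands<s le = ℕP.<-≤-trans (s≤s (ℕP.m≤m+n _ _)) le , ℕP.<-≤-trans (s≤s (ℕP.m≤n+m _ _)) le

      aboveAntidiagonal : ∀ i t → suc (i ℕ.+ t) < s → D (r ℕ.+ i) (r ℕ.+ t) ≡ 0#
      aboveAntidiagonal i t lt = trans (corner i t i<s t<s (ℕP.<⇒≤ r+i+t<j)) (earlier _ r+i+t<j)
        where
        i<s = proj₁ (summands<s (ℕP.<⇒≤ lt))
        t<s = proj₂ (summands<s (ℕP.<⇒≤ lt))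
        r+i+t<j : r ℕ.+ (i ℕ.+ t) < j
        r+i+t<j = ℕP.≤-pred (subst (suc (r ℕ.+ (i ℕ.+ t)) <_) r+s≡k
                    (subst (_< r ℕ.+ s) (ℕP.+-suc r (i ℕ.+ t)) (ℕP.+-monoʳ-< r lt)))

      onAntidiagonal : ∀ i t → suc (i ℕ.+ t) ≡ s → D (r ℕ.+ i) (r ℕ.+ t) ≡ defect j
      onAntidiagonal i t eq = trans (corner i t i<s t<s (ℕP.≤-reflexive r+i+t≡j)) (cong defect r+i+t≡j)
        where
        i<s = proj₁ (summands<s (ℕP.≤-reflexive eq))
        t<s = proj₂ (summands<s (ℕP.≤-reflexive eq))
        r+i+t≡j : r ℕ.+ (i ℕ.+ t) ≡ j
        r+i+t≡j = ℕP.suc-injective (trans (sym (ℕP.+-suc r (i ℕ.+ t))) (trans (cong (r ℕ.+_) eq) r+s≡k))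

      module Kernel (y : ℕ → Carrier) (Dy≡0 : ∀ a → a < suc j → ∑ (suc j) (λ b → D a b * y b) ≡ 0#) where

        top : ∀ a → a < r → ∑ r (λ b → ent M a b * y b) ≡ 0#
        top a a<r = begin
          ∑ r (λ b → ent M a b * y b)
            ≡⟨ ∑-cong r (λ b b<r → cong (_* y b) (sym (topLeft a b a<r b<r))) ⟩
          ∑ r (λ b → D a b * y b)
            ≡⟨ sym (trans (cong (∑ r (λ b → D a b * y b) +_) right≡0) (+-identityʳ _)) ⟩
          ∑ r (λ b → D a b * y b) + ∑ s (λ t → D a (r ℕ.+ t) * y (r ℕ.+ t))
            ≡⟨ sym (∑-split-at-r _) ⟩
          ∑ (suc j) (λ b → D a b * y b)
            ≡⟨ Dy≡0 a (in-k a<r) ⟩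
          0# ∎
          where
          right≡0 = ∑-≡0 s λ t t<s → trans (cong (_* y (r ℕ.+ t)) (topRight a t a<r t<s)) (zeroˡ _)

        y-low : ∀ c → c < r → y c ≡ 0#
        y-low c c<r = begin
          y c                                                 ≡⟨ sym (∑-unitSeq-* r c y c<r) ⟩
          ∑ r (λ b → unitSeq c b * y b)                       ≡⟨ ∑-cong r (λ b b<r → cong (_* y b) (sym (B·H≡I c b c<r b<r))) ⟩
          ∑ r (λ b → ∑ r (λ a → ent B c a * ent M a b) * y b)  ≡⟨ ∑-cong r (λ b _ → ∑-*ʳ r (y b) _) ⟩
          ∑ r (λ b → ∑ r (λ a → ent B c a * ent M a b * y b))  ≡⟨ ∑-comm r r _ ⟩
          ∑ r (λ a → ∑ r (λ b → ent B c a * ent M a b * y b))  ≡⟨ ∑-cong r (λ a _ → sym (bilinear-row a)) ⟩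
          ∑ r (λ a → ent B c a * ∑ r (λ b → ent M a b * y b))  ≡⟨ ∑-≡0 r (λ a a<r → trans (cong (ent B c a *_) (top a a<r)) (zeroʳ _)) ⟩
          0#                                                  ∎
          where
          bilinear-row : ∀ a → ent B c a * ∑ r (λ b → ent M a b * y b) ≡ ∑ r (λ b → ent B c a * ent M a b * y b)
          bilinear-row a = trans (∑-*ˡ r (ent B c a) _) (∑-cong r (λ b _ → sym (*-assoc _ _ _)))

        bottom : ∀ i → i < s → ∑ s (λ t → D (r ℕ.+ i) (r ℕ.+ t) * y (r ℕ.+ t)) ≡ 0#
        bottom i i<s = begin
          ∑ s (λ t → D (r ℕ.+ i) (r ℕ.+ t) * y (r ℕ.+ t))
            ≡⟨ sym (trans (cong (_+ ∑ s (λ t → D (r ℕ.+ i) (r ℕ.+ t) * y (r ℕ.+ t))) left≡0) (+-identityˡ _)) ⟩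
          ∑ r (λ b → D (r ℕ.+ i) b * y b) + ∑ s (λ t → D (r ℕ.+ i) (r ℕ.+ t) * y (r ℕ.+ t))
            ≡⟨ sym (∑-split-at-r _) ⟩
          ∑ (suc j) (λ b → D (r ℕ.+ i) b * y b)
            ≡⟨ Dy≡0 (r ℕ.+ i) (r+t<k i i<s) ⟩
          0# ∎
          where
          left≡0 = ∑-≡0 r λ b b<r → trans (cong (D (r ℕ.+ i) b *_) (y-low b b<r)) (zeroʳ _)

        y≡0 : ∀ b → b < suc j → y b ≡ 0#
        y≡0 b b<k with r ≤? b
        ... | no r≰b = y-low b (ℕP.≰⇒> r≰b)
        ... | yes r≤b = subst (λ c → y c ≡ 0#) (ℕP.m+[n∸m]≡n r≤b)
          (antidiagonal-kernel s (λ i t → D (r ℕ.+ i) (r ℕ.+ t)) (λ t → y (r ℕ.+ t)) (defect j) defect≢0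
             aboveAntidiagonal onAntidiagonal bottom (b ∸ r)
             (ℕP.+-cancelˡ-< r _ _ (subst (_< r ℕ.+ s) (sym (ℕP.m+[n∸m]≡n r≤b)) (subst (b <_) (sym r+s≡k) b<k))))

      trivialKernel : TrivialKernel H
      trivialKernel v Hv≡0 i = trans (sym (shear-w≗v i))
        (shear-zero (reduceΦ (suc j) r x) (reduceΦ-zeroAbove (suc j) r x) w
          (λ i′ → trans (sym (pad-toℕ w i′)) (Kernel.y≡0 (pad w) Dw≡0 (toℕ i′) (FinP.toℕ<n i′))) i)
        where
        preimage = shear-surjective (suc j) (reduceΦ (suc j) r x) (reduceΦ-dependsAbove (suc j) r x) v
        w = proj₁ preimage
        shear-w≗v = proj₂ preimage
        Dw≡0 = reduced-kernel r x H v w Hv≡0 shear-w≗v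

      invertible : Invertible H
      invertible = trivialKernel⇒invertible H trivialKernel

    module Maximal (maximal : ∀ k → r < k → (k<n : k < n) → ¬ Invertible (sub (ℕP.<⇒≤ k<n) M)) where

      defect-vanishes : ∀ j → suc j < n → defect j ≡ 0#
      defect-vanishes = <-rec (λ j → suc j < n → defect j ≡ 0#) step
        where
        step : ∀ j → (∀ {j′} → j′ < j → suc j′ < n → defect j′ ≡ 0#) → suc j < n → defect j ≡ 0#
        step j earlier j<n with j <? r | defect j ≟ 0#
        ... | yes j<r | _ = defect-< j j<r
        ... | no _ | yes defect≡0 = defect≡0
        ... | no j≮r | no defect≢0 = ⊥-elim (maximal (suc j) (s≤s r≤j) j<n
                (FirstDefect.invertible j r≤j j<n (λ j′ j′<j → earlier j′<j (ℕP.<-trans (s≤s j′<j) j<n)) defect≢0))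
          where r≤j = ℕP.≮⇒≥ j≮r

      open ReducedEntries n (ent M) m≡α

      reduced-upper≡0 : ∀ a b → a < r → r ≤ b → b < n → colReduce r x (rowReduce r x (ent M)) a b ≡ 0#
      reduced-upper≡0 a b a<r r≤b b<n = trans (reduced-upper a b a<r r≤b b<n)
        (defect-vanishes _ (ℕP.≤-trans (s≤s (subst (a ℕ.+ (b ∸ r) <_) (ℕP.m+[n∸m]≡n r≤b) (ℕP.+-monoˡ-< (b ∸ r) a<r))) b<n))

      reduced-lower≡0 : ∀ a b → r ≤ a → a < n → b < r → colReduce r x (rowReduce r x (ent M)) a b ≡ 0#
      reduced-lower≡0 a b r≤a a<n b<r = trans (reduced-lower a b r≤a a<n b<r)
        (defect-vanishes _ (ℕP.≤-trans (s≤s (subst (a ∸ r ℕ.+ b <_) (ℕP.m∸n+n≡m r≤a) (ℕP.+-monoʳ-< (a ∸ r) b<r))) a<n))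

  module _ {r n : ℕ} (r≤n : r ≤ n) where

    extendΦ : Perturbation → Perturbation
    extendΦ Φ u a = when (a <? r) (Φ u a)

    extendShear : Shear₀ r → Shear₀ n
    extendShear (mkShear₀ (mkShear Φ dep) zero-above) = mkShear₀ (mkShear (extendΦ Φ) dep′) zero-above′
      where
      dep′ : DependsAbove n (extendΦ Φ)
      dep′ u u′ a agree with a <? r
      ... | yes _ = dep u u′ a (λ j a<j j<r → agree j a<j (ℕP.<-≤-trans j<r r≤n))
      ... | no _ = refl
      zero-above′ : ZeroAbove n (extendΦ Φ)
      zero-above′ u a u≡0 with a <? r
      ... | yes _ = zero-above u a (λ j a<j j<r → u≡0 j a<j (ℕP.<-≤-trans j<r r≤n))
      ... | no _ = refl

    restrict : Vec n → Vec r
    restrict v i = v (inject≤ i r≤n)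

    pad-restrict : ∀ (v : Vec n) c → c < r → pad (restrict v) c ≡ pad v c
    pad-restrict v c c<r = trans (pad-fromℕ< (restrict v) c c<r) (trans (cong v (FinP.toℕ-injective
        (trans (FinP.toℕ-inject≤ _ r≤n) (trans (FinP.toℕ-fromℕ< c<r) (sym (FinP.toℕ-fromℕ< (ℕP.<-≤-trans c<r r≤n)))))))
        (sym (pad-fromℕ< v c (ℕP.<-≤-trans c<r r≤n))))

    pad-applyShears₀-extend : ∀ (Ts : List (Shear₀ r)) (v : Vec n) →
      (∀ c → c < r → pad (applyShears₀ (map extendShear Ts) v) c ≡ pad (applyShears₀ Ts (restrict v)) c) ×
      (∀ c → r ≤ c → pad (applyShears₀ (map extendShear Ts) v) c ≡ pad v c)
    pad-applyShears₀-extend [] v = (λ c c<r → sym (pad-restrict v c c<r)) , (λ c _ → refl)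
    pad-applyShears₀-extend (mkShear₀ (mkShear Φ dep) _ ∷ Ts) v = low , high
      where
      V = applyShears₀ (map extendShear Ts) v
      W = applyShears₀ Ts (restrict v)
      IH = pad-applyShears₀-extend Ts v
      low : ∀ c → c < r → pad (shear (extendΦ Φ) V) c ≡ pad (shear Φ W) c
      low c c<r = trans (pad-shear (extendΦ Φ) V c (ℕP.<-≤-trans c<r r≤n))
        (trans (cong₂ _+_ (proj₁ IH c c<r) (offset (c <? r))) (sym (pad-shear Φ W c c<r)))
        where
        offset : (d : Dec (c < r)) → when d (Φ (pad V) c) ≡ Φ (pad W) c
        offset (yes _) = dep _ _ c (λ j _ j<r → proj₁ IH j j<r)
        offset (no c≮r) = ⊥-elim (c≮r c<r)
      high : ∀ c → r ≤ c → pad (shear (extendΦ Φ) V) c ≡ pad v c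
      high c r≤c with c <? n
      ... | no c≮n = trans (pad-≥ _ c (ℕP.≮⇒≥ c≮n)) (sym (pad-≥ v c (ℕP.≮⇒≥ c≮n)))
      ... | yes c<n = trans (pad-shear (extendΦ Φ) V c c<n) (trans (cong₂ _+_ (proj₂ IH c r≤c) (offset (c <? r))) (+-identityʳ _))
        where
        offset : (d : Dec (c < r)) → when d (Φ (pad V) c) ≡ 0#
        offset (yes c<r) = ⊥-elim (ℕP.<⇒≱ c<r r≤c)
        offset (no _) = refl

  BlockDiagonal : ℕ → ℕ → (ℕ → ℕ → Carrier) → Set
  BlockDiagonal n r m =
    (∀ a b → a < r → r ≤ b → b < n → m a b ≡ 0#) × (∀ a b → r ≤ a → a < n → b < r → m a b ≡ 0#)

  lowerForm : ℕ → ℕ → (ℕ → ℕ → Carrier) → (ℕ → Carrier) → Carrier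
  lowerForm n r m v = ∑ (n ∸ r) (λ p → ∑ (n ∸ r) (λ q → v (r ℕ.+ p) * m (r ℕ.+ p) (r ℕ.+ q) * v (r ℕ.+ q)))

  bilinear-blockDiagonal : ∀ n r → r ≤ n → (m : ℕ → ℕ → Carrier) (v : ℕ → Carrier) → BlockDiagonal n r m →
    bilinear n m v v ≡ bilinear r m v v + lowerForm n r m v
  bilinear-blockDiagonal n r r≤n m v (upper≡0 , lower≡0) = begin
    ∑ n (λ p → ∑ n (t p))
      ≡⟨ ∑-cong n (λ p _ → split (t p)) ⟩
    ∑ n (λ p → ∑ r (t p) + ∑ s (λ q → t p (r ℕ.+ q)))
      ≡⟨ split _ ⟩
    ∑ r (λ p → ∑ r (t p) + ∑ s (λ q → t p (r ℕ.+ q))) + ∑ s (λ p → ∑ r (t (r ℕ.+ p)) + ∑ s (λ q → t (r ℕ.+ p) (r ℕ.+ q)))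
      ≡⟨ cong₂ _+_ (∑-cong r (λ p p<r → trans (cong (∑ r (t p) +_) (∑-≡0 s (λ q q<s → upper p q p<r q<s))) (+-identityʳ _)))
                   (∑-cong s (λ p p<s → trans (cong (_+ ∑ s (λ q → t (r ℕ.+ p) (r ℕ.+ q))) (∑-≡0 r (λ q q<r → lower p q p<s q<r)))
                                              (+-identityˡ _))) ⟩
    bilinear r m v v + lowerForm n r m v ∎
    where
    s = n ∸ r
    t : ℕ → ℕ → Carrier
    t p q = v p * m p q * v q
    split : ∀ (f : ℕ → Carrier) → ∑ n f ≡ ∑ r f + ∑ s (λ i → f (r ℕ.+ i))
    split f = trans (cong (λ K → ∑ K f) (sym (ℕP.m+[n∸m]≡n r≤n))) (∑-split r s f)
    r+i<n : ∀ i → i < s → r ℕ.+ i < n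
    r+i<n i i<s = subst (r ℕ.+ i <_) (ℕP.m+[n∸m]≡n r≤n) (ℕP.+-monoʳ-< r i<s)
    zero-middle : ∀ {a b c} → b ≡ 0# → a * b * c ≡ 0#
    zero-middle {a} {b} {c} b≡0 = trans (cong (λ z → a * z * c) b≡0) (trans (cong (_* c) (zeroʳ a)) (zeroˡ c))
    upper : ∀ p q → p < r → q < s → t p (r ℕ.+ q) ≡ 0#
    upper p q p<r q<s = zero-middle (upper≡0 p _ p<r (ℕP.m≤m+n r q) (r+i<n q q<s))
    lower : ∀ p q → p < s → q < r → t (r ℕ.+ p) q ≡ 0#
    lower p q p<s q<r = zero-middle (lower≡0 _ q (ℕP.m≤m+n r p) (r+i<n p p<s) q<r)

  lowerForm-cong : ∀ n r {m m′ : ℕ → ℕ → Carrier} {v v′ : ℕ → Carrier} → r ≤ n →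
    (∀ a b → r ≤ a → a < n → r ≤ b → b < n → m a b ≡ m′ a b) → (∀ a → r ≤ a → v a ≡ v′ a) →
    lowerForm n r m v ≡ lowerForm n r m′ v′
  lowerForm-cong n r r≤n m≡ v≡ = ∑-cong (n ∸ r) λ p p<s → ∑-cong (n ∸ r) λ q q<s →
    cong₂ _*_ (cong₂ _*_ (v≡ _ (ℕP.m≤m+n r p)) (m≡ _ _ (ℕP.m≤m+n r p) (r+i<n p p<s) (ℕP.m≤m+n r q) (r+i<n q q<s)))
              (v≡ _ (ℕP.m≤m+n r q))
    where
    r+i<n : ∀ i → i < n ∸ r → r ℕ.+ i < n
    r+i<n i i<s = subst (r ℕ.+ i <_) (ℕP.m+[n∸m]≡n r≤n) (ℕP.+-monoʳ-< r i<s)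

  ent-replaceTL-inside : ∀ {r n} (r≤n : r ≤ n) (A : Mat r) (N : Mat n) a b → a < r → b < r →
    ent (replaceTL r≤n A N) a b ≡ ent A a b
  ent-replaceTL-inside {r} r≤n A N a b a<r b<r =
    trans (ent-fromℕ< _ a b a<n b<n) (trans inside
      (sym (ent-fromℕ< A a b a<r b<r)))
    where
    a<n = ℕP.<-≤-trans a<r r≤n
    b<n = ℕP.<-≤-trans b<r r≤n
    inside : replaceTL r≤n A N (fromℕ< a<n) (fromℕ< b<n) ≡ A (fromℕ< a<r) (fromℕ< b<r)
    inside with toℕ (fromℕ< a<n) <? r | toℕ (fromℕ< b<n) <? r
    ... | yes a′<r | yes b′<r = cong₂ A (FinP.fromℕ<-cong _ _ (FinP.toℕ-fromℕ< a<n) a′<r a<r)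
                                        (FinP.fromℕ<-cong _ _ (FinP.toℕ-fromℕ< b<n) b′<r b<r)
    ... | no a′≮r | _ = ⊥-elim (a′≮r (subst (_< r) (sym (FinP.toℕ-fromℕ< a<n)) a<r))
    ... | yes _ | no b′≮r = ⊥-elim (b′≮r (subst (_< r) (sym (FinP.toℕ-fromℕ< b<n)) b<r))

  ent-replaceTL-outside : ∀ {r n} (r≤n : r ≤ n) (A : Mat r) (N : Mat n) a b → a < n → b < n → ¬ (a < r × b < r) →
    ent (replaceTL r≤n A N) a b ≡ ent N a b
  ent-replaceTL-outside {r} r≤n A N a b a<n b<n outside =
    trans (ent-fromℕ< _ a b a<n b<n) (trans kept (sym (ent-fromℕ< N a b a<n b<n)))
    where
    outside′ : ¬ (toℕ (fromℕ< a<n) < r × toℕ (fromℕ< b<n) < r)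
    outside′ (a′<r , b′<r) = outside (subst (_< r) (FinP.toℕ-fromℕ< a<n) a′<r , subst (_< r) (FinP.toℕ-fromℕ< b<n) b′<r)
    kept : replaceTL r≤n A N (fromℕ< a<n) (fromℕ< b<n) ≡ N (fromℕ< a<n) (fromℕ< b<n)
    kept with toℕ (fromℕ< a<n) <? r | toℕ (fromℕ< b<n) <? r
    ... | yes a′<r | yes b′<r = ⊥-elim (outside′ (a′<r , b′<r))
    ... | yes _ | no _ = refl
    ... | no _ | yes _ = refl
    ... | no _ | no _ = refl

  quad-≐ : ∀ {n} {M M′ : Mat n} → M ≐ M′ → ∀ v → quad M v ≡ quad M′ v
  quad-≐ M≐M′ v = sumF-cong λ i → sumF-cong λ j → cong (λ z → v i * z * v j) (M≐M′ i j)

  quad-replaceTL : ∀ {r n} (r≤n : r ≤ n) (A : Mat r) (N : Mat n) → BlockDiagonal n r (ent N) →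
    (Ts : List (Shear₀ r)) → (∀ u → quad A u ≡ quad (sub r≤n N) (applyShears₀ Ts u)) →
    ∀ v → quad (replaceTL r≤n A N) v ≡ quad N (applyShears₀ (map (extendShear r≤n) Ts) v)
  quad-replaceTL {r} {n} r≤n A N blocks@(upper≡0 , lower≡0) Ts A≅N v = begin
    quad R v
      ≡⟨ quad≡bilinear R v ⟩
    bilinear n (ent R) (pad v) (pad v)
      ≡⟨ bilinear-blockDiagonal n r r≤n (ent R) (pad v) R-blocks ⟩
    bilinear r (ent R) (pad v) (pad v) + lowerForm n r (ent R) (pad v)
      ≡⟨ cong₂ _+_ (bilinear-cong r (ent-replaceTL-inside r≤n A N) (λ c c<r → sym (pad-restrict r≤n v c c<r))
                                                               (λ c c<r → sym (pad-restrict r≤n v c c<r)))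
                   (lowerForm-cong n r {ent R} {ent N} {pad v} r≤n (λ a b r≤a a<n _ b<n → ent-replaceTL-outside r≤n A N a b a<n b<n
                                                                     (λ (a<r , _) → ℕP.<⇒≱ a<r r≤a))
                                            (λ _ _ → refl)) ⟩
    bilinear r (ent A) (pad (restrict r≤n v)) (pad (restrict r≤n v)) + lowerForm n r (ent N) (pad v)
      ≡⟨ cong (_+ lowerForm n r (ent N) (pad v))
              (trans (sym (quad≡bilinear A _)) (trans (A≅N (restrict r≤n v)) (quad≡bilinear (sub r≤n N) W))) ⟩
    bilinear r (ent (sub r≤n N)) (pad W) (pad W) + lowerForm n r (ent N) (pad v)
      ≡⟨ cong₂ _+_ (bilinear-cong r (ent-sub r≤n N) (λ c c<r → sym (proj₁ V≈ c c<r)) (λ c c<r → sym (proj₁ V≈ c c<r)))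
                   (lowerForm-cong n r {ent N} {ent N} {pad v} {pad V} r≤n (λ _ _ _ _ _ _ → refl) (λ c r≤c → sym (proj₂ V≈ c r≤c))) ⟩
    bilinear r (ent N) (pad V) (pad V) + lowerForm n r (ent N) (pad V)
      ≡⟨ sym (bilinear-blockDiagonal n r r≤n (ent N) (pad V) blocks) ⟩
    bilinear n (ent N) (pad V) (pad V)
      ≡⟨ sym (quad≡bilinear N V) ⟩
    quad N V ∎
    where
    R = replaceTL r≤n A N
    W = applyShears₀ Ts (restrict r≤n v)
    V = applyShears₀ (map (extendShear r≤n) Ts) v
    V≈ = pad-applyShears₀-extend r≤n Ts v
    R-blocks : BlockDiagonal n r (ent R)
    R-blocks = (λ a b a<r r≤b b<n → trans (ent-replaceTL-outside r≤n A N a b (ℕP.<-≤-trans a<r r≤n) b<n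
                                               (λ (_ , b<r) → ℕP.<⇒≱ b<r r≤b)) (upper≡0 a b a<r r≤b b<n))
             , (λ a b r≤a a<n b<r → trans (ent-replaceTL-outside r≤n A N a b a<n (ℕP.<-≤-trans b<r r≤n)
                                               (λ (a<r , _) → ℕP.<⇒≱ a<r r≤a)) (lower≡0 a b r≤a a<n b<r))

  search-maximal : ∀ {n} (M : Mat n) k (k<n : k < n) (piv : Pivot M) → search M k k<n ≡ just piv →
    ∀ k′ → Pivot.r piv < k′ → k′ ≤ k → (k′<n : k′ < n) → ¬ Invertible (sub (ℕP.<⇒≤ k′<n) M)
  search-maximal M zero k<n piv () k′ r<k′ k′≤k k′<n
  search-maximal M (suc k) k<n piv found k′ r<k′ k′≤k k′<n with invertible? (sub (ℕP.<⇒≤ k<n) M)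
  search-maximal M (suc k) k<n piv refl k′ r<k′ k′≤k k′<n | yes _ = ⊥-elim (ℕP.<⇒≱ r<k′ k′≤k)
  ... | no singular with ℕP.m≤n⇒m<n∨m≡n k′≤k
  ...   | inj₁ k′<1+k = search-maximal M k _ piv found k′ r<k′ (ℕP.≤-pred k′<1+k) k′<n
  ...   | inj₂ refl = singular

  pivotOf-maximal : ∀ {n} (M : Mat n) (piv : Pivot M) → pivotOf M ≡ just piv →
    ∀ k′ → Pivot.r piv < k′ → (k′<n : k′ < n) → ¬ Invertible (sub (ℕP.<⇒≤ k′<n) M)
  pivotOf-maximal {zero} M piv ()
  pivotOf-maximal {suc n} M piv found k′ r<k′ k′<n =
    search-maximal M n (ℕP.n<1+n n) piv found k′ r<k′ (ℕP.≤-pred k′<n) k′<n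

  sub-IsHankel : ∀ {r n} (r≤n : r ≤ n) (M : Mat n) → IsHankel M → IsHankel (sub r≤n M)
  sub-IsHankel r≤n M hank i j i′ j′ sum≡ = hank _ _ _ _
    (trans (cong₂ ℕ._+_ (FinP.toℕ-inject≤ i r≤n) (FinP.toℕ-inject≤ j r≤n))
      (trans sum≡ (sym (cong₂ ℕ._+_ (FinP.toℕ-inject≤ i′ r≤n) (FinP.toℕ-inject≤ j′ r≤n)))))

  sub-colOps-rowOps : ∀ {r n} (r≤n : r ≤ n) (x : Vec r) (M : Mat n) →
    sub r≤n (colOps x (rowOps x M)) ≐ sub r≤n M
  sub-colOps-rowOps {r} r≤n x M i j = begin
    colOps x (rowOps x M) (inject≤ i r≤n) (inject≤ j r≤n)
      ≡⟨ sym (ent-toℕ (colOps x (rowOps x M)) (inject≤ i r≤n) (inject≤ j r≤n)) ⟩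
    ent (colOps x (rowOps x M)) (toℕ (inject≤ i r≤n)) (toℕ (inject≤ j r≤n))
      ≡⟨ ent-colOps-rowOps x M r≤n _ _ (FinP.toℕ<n _) (FinP.toℕ<n _) ⟩
    colReduce r (pad x) (rowReduce r (pad x) (ent M)) (toℕ (inject≤ i r≤n)) (toℕ (inject≤ j r≤n))
      ≡⟨ colReduce-rowReduce-< r (pad x) (ent M) _ _ (in-block i) (in-block j) ⟩
    ent M (toℕ (inject≤ i r≤n)) (toℕ (inject≤ j r≤n))
      ≡⟨ ent-toℕ M _ _ ⟩
    M (inject≤ i r≤n) (inject≤ j r≤n) ∎
    where
    in-block : ∀ i → toℕ (inject≤ i r≤n) < r
    in-block i = subst (_< r) (sym (FinP.toℕ-inject≤ i r≤n)) (FinP.toℕ<n i)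

  reduceF-shears : ∀ f {n} (M : Mat n) → IsHankel M →
    ∃ λ (Ts : List (Shear₀ n)) → ∀ v → quad (reduceF f M) v ≡ quad M (applyShears₀ Ts v)
  reduceF-shears zero M hank = [] , λ _ → refl
  reduceF-shears (suc f) {n} M hank with pivotOf M in found
  ... | nothing = [] , λ _ → refl
  ... | just (pivot r _ r<n (B , inv)) =
    reduceShear n r (pad x) ∷ map (extendShear r≤n) Ts , λ v →
      trans (quad-replaceTL r≤n A N N-blocks Ts A≅N v) (quad-colOps-rowOps x M r≤n _)
    where
    r≤n = ℕP.<⇒≤ r<n
    x = solveX M r<n B
    N = colOps x (rowOps x M)
    A = reduceF f (sub r≤n M)
    open Reduction M hank r r<n B inv using (module Maximal)
    open Maximal (pivotOf-maximal M _ found)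
    N-blocks : BlockDiagonal n r (ent N)
    N-blocks = (λ a b a<r r≤b b<n → trans (ent-colOps-rowOps x M r≤n a b (ℕP.<-trans a<r r<n) b<n)
                                          (reduced-upper≡0 a b a<r r≤b b<n))
             , (λ a b r≤a a<n b<r → trans (ent-colOps-rowOps x M r≤n a b a<n (ℕP.<-trans b<r r<n))
                                          (reduced-lower≡0 a b r≤a a<n b<r))
    IH = reduceF-shears f (sub r≤n M) (sub-IsHankel r≤n M hank)
    Ts = proj₁ IH
    A≅N : ∀ u → quad A u ≡ quad (sub r≤n N) (applyShears₀ Ts u)
    A≅N u = trans (proj₂ IH u) (sym (quad-≐ (sub-colOps-rowOps r≤n x M) _))

lemma3p3 : (F : FiniteField) → let open FF F in
    ∀ (n : ℕ) (H : Mat n) → IsHankel H →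
    (𝒬 H ↭ 𝒬 (𝓡 H)) × (𝒬𝓜 H ↭ 𝒬𝓜 (𝓡 H)) × (𝒬₁ H ↭ 𝒬₁ (𝓡 H))
lemma3p3 F n H hank =
  ↭-sym (𝒬-↭ F (𝓡 H) H Ts 𝓡≅H) , ↭-sym (𝒬𝓜-↭ F (𝓡 H) H Ts 𝓡≅H) , ↭-sym (𝒬₁-↭ F (𝓡 H) H Ts 𝓡≅H)
  where
  open FF F using (𝓡)
  Ts = proj₁ (reduceF-shears F n H hank)
  𝓡≅H = proj₂ (reduceF-shears F n H hank)
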